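{- For every algebraic language $L$, the substitution rule is derivable in the term calculus of $L$: every sequent derivable in the term calculus of $L$ is derivable without using the substitution rule.
   Context: Algebraic languages: fix a finitary many-sorted signature $\Sigma$ (atomic types; functional constants $f\colon B_1,\dots,B_n\to B_{n+1}$). Types are finite sequences of atomic types (juxtaposition; $\emptyset$ empty). Raw terms: $t::=\emptyset\mid x\mid f(t_1,\dots,t_n)\mid tt$, tensor associative with unit $\emptyset$; $t[s/x]$ is simultaneous substitution of $s=s_1\dots s_n$ for distinct atomic variables $x=x_1\dots x_n$. Sequents $x:A\vdash t:B$ with $x$ a sequence of distinct atomic variables. Term calculus: Variables $x:A\vdash x:A$ ($x,A$ atomic); Functions: from $x_i:A_i\vdash t_i:B_i$ ($i=1,\dots,n$) infer $x_1\dots x_n:A_1\dots A_n\vdash f(t_1,\dots,t_n):B_{n+1}$; Substitution: from $x:A\vdash s:B$, $y:B\vdash t:C$ infer $x:A\vdash t[s/y]:C$; Unit $\emptyset:\emptyset\vdash\emptyset:\emptyset$; Tensor: from $x:A\vdash s:B$, $y:C\vdash t:D$ infer $xy:AC\vdash st:BD$; Weakening: from $x_1x_3:A_1A_3\vdash t:B$ infer $x_1x_2x_3:A_1A_2A_3\vdash t:B$; Exchange: from $x:A\vdash t:B$ infer $\sigma x:\sigma A\vdash t:B$; Contraction: from $x_1xx'x_2:A_1AAA_2\vdash t:B$ infer $x_1xx_2:A_1AA_2\vdash t[x/x']:B$ (variables in concatenated contexts always distinct). An algebraic language $L$ is $\Sigma$ plus a subset of {weakening, exchange, contraction}; its term calculus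 consists of the variable, function, substitution, unit and tensor rules together with the structural rules of $L$. -}

module Defs where

open import Data.Nat using (ℕ; _≟_)
open import Data.Bool using (Bool; true; false)
open import Data.Product using (_×_; _,_; proj₁; proj₂)
open import Data.List using (List; []; _∷_; _++_; map; zip; concat)
open import Data.List.Relation.Unary.Unique.Propositional using (Unique)
open import Data.List.Relation.Binary.Permutation.Propositional using (_↭_)
open import Relation.Binary.PropositionalEquality using (_≡_)
open import Relation.Nullary using (yes; no)

record Signature : Set₁ where
  field
    Sort : Set
    Fun  : Set
    dom  : Fun → List Sort
    cod  : Fun → Sort

record Language : Set₁ where
  field
    sig         : Signature
    weakening   : Bool
    exchange    : Bool
    contraction : Bool
  open Signature sig public

Var : Set
Var = ℕ

module Syntax (Σ : Signature) where
  open Signature Σ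

  -- Raw terms modulo associativity/unit of the tensor: a term is a
  -- (possibly empty) tensor of atomic terms, i.e. a list of atomic terms.
  -- ∅ = [], tensor = _++_.
  data ATerm : Set where
    var : Var → ATerm
    app : Fun → List (List ATerm) → ATerm

  Term : Set
  Term = List ATerm

  Type : Set
  Type = List Sort

  Ctx : Set
  Ctx = List (Var × Sort)

  vars : Ctx → List Var
  vars = map proj₁

  types : Ctx → Type
  types = map proj₂

  Sub : Set
  Sub = List (Var × ATerm)

  lookupVar : Sub → Var → Term
  lookupVar [] x = var x ∷ []
  lookupVar ((y , s) ∷ σ) x with x ≟ y
  ... | yes _ = s ∷ []
  ... | no  _ = lookupVar σ x

  mutual
    substA : Sub → ATerm → Term
    substA σ (var x)    = lookupVar σ x
    substA σ (app f ts) = app f (substTs σ ts) ∷ []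

    substT : Sub → Term → Term
    substT σ []      = []
    substT σ (a ∷ t) = substA σ a ++ substT σ t

    substTs : Sub → List Term → List Term
    substTs σ []       = []
    substTs σ (t ∷ ts) = substT σ t ∷ substTs σ ts

  _[_/_] : Term → Term → List Var → Term
  t [ s / x ] = substT (zip x s) t

module Calculus (L : Language) where
  open Language L
  open Syntax sig public

  -- Derivable sequents x : A ⊢ t : B in the term calculus of L.
  -- The flag `sub` says whether the substitution rule may be used.
  mutual
    data _⊢[_]_∶_ : Ctx → Bool → Term → Type → Set where
      variable′ : ∀ {b} (x : Var) (A : Sort) →
        ((x , A) ∷ []) ⊢[ b ] (var x ∷ []) ∶ (A ∷ [])
      function : ∀ {b} (f : Fun) {Γs ts} →
        Args b Γs ts (dom f) →
        Unique (vars (concat Γs)) →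
        concat Γs ⊢[ b ] (app f ts ∷ []) ∶ (cod f ∷ [])
      substitution : ∀ {b Γ Δ s t B C} →
        b ≡ true →
        Γ ⊢[ b ] s ∶ B →
        Δ ⊢[ b ] t ∶ C →
        types Δ ≡ B →
        Γ ⊢[ b ] (t [ s / vars Δ ]) ∶ C
      unit : ∀ {b} → [] ⊢[ b ] [] ∶ []
      tensor : ∀ {b Γ Δ s t B D} →
        Γ ⊢[ b ] s ∶ B →
        Δ ⊢[ b ] t ∶ D →
        Unique (vars (Γ ++ Δ)) →
        (Γ ++ Δ) ⊢[ b ] (s ++ t) ∶ (B ++ D)
      weaken : ∀ {b Γ₁ Γ₂ Γ₃ t B} →
        weakening ≡ true →
        (Γ₁ ++ Γ₃) ⊢[ b ] t ∶ B →
        Unique (vars (Γ₁ ++ Γ₂ ++ Γ₃)) →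
        (Γ₁ ++ Γ₂ ++ Γ₃) ⊢[ b ] t ∶ B
      exch : ∀ {b Γ Γ′ t B} →
        exchange ≡ true →
        Γ ⊢[ b ] t ∶ B →
        Γ ↭ Γ′ →
        Γ′ ⊢[ b ] t ∶ B
      contract : ∀ {b Γ₁ Δ Δ′ Γ₂ t B} →
        contraction ≡ true →
        types Δ ≡ types Δ′ →
        (Γ₁ ++ Δ ++ Δ′ ++ Γ₂) ⊢[ b ] t ∶ B →
        (Γ₁ ++ Δ ++ Γ₂) ⊢[ b ] (t [ map var (vars Δ) / vars Δ′ ]) ∶ B

    data Args (b : Bool) : List Ctx → List Term → List Sort → Set where
      []  : Args b [] [] []
      _∷_ : ∀ {Γ t B Γs ts Bs} →
        Γ ⊢[ b ] t ∶ (B ∷ []) → Args b Γs ts Bs →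
        Args b (Γ ∷ Γs) (t ∷ ts) (B ∷ Bs)

-- Substitution is admissible, by induction on the derivation of the substituted term s, cut
-- into a block Δx of the context Δa Δx Δb of t.  Variables become renamings, tensors split the
-- block, weakening and exchange commute with the cut, and a contraction in s is performed after
-- the cut, once the context of t has been renamed apart from the variables of its premise.  For
-- s = f(s₁,…,sₙ) the variable x is first expanded to f(y₁,…,yₙ), with fresh yᵢ, throughout the
-- derivation of t, and then each sᵢ is cut into yᵢ.  Expansion goes by induction on the number
-- of contractions: when x is identified with some x′ by a contraction, the premise is expanded
-- at x and then at x′ (a derivation with no more contractions), and the two blocks of fresh
-- variables are contracted instead.

module Submission where

open import Defs
open import Data.Nat using (ℕ; suc; pred; _+_; _≤_; _<_; _≟_; s≤s)
open import Data.Nat.Properties using (≤-refl; ≤-trans; ≤-reflexive; m≤m+n; m≤n+m; +-cancelˡ-≡; <-irrefl; <⇒≢; suc-injective)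
open import Data.Bool using (true; false)
open import Data.Product using (_×_; _,_; proj₁; proj₂; map₁; Σ-syntax; ∃-syntax)
open import Data.Sum using (_⊎_; inj₁; inj₂; [_,_]; [_,_]′)
open import Data.Unit using (⊤; tt)
open import Data.Empty using (⊥; ⊥-elim)
open import Data.List using (List; []; _∷_; _++_; map; length; concat; concatMap; zip; applyUpTo)
open import Data.List.Properties
  using (∷-injective; ∷-injectiveˡ; map-++; map-∘; map-cong-local; ++-assoc; ++-identityʳ; ++-monoid;
         length-map; length-++; length-applyUpTo; concat-map-[_]; concatMap-++)
open import Data.List.Extrema.Nat using (max; xs≤max)
open import Data.List.Relation.Unary.All as All using (All; []; _∷_)
open import Data.List.Relation.Unary.All.Properties using (¬Any⇒All¬)
open import Data.List.Relation.Unary.Any using (here; there)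
open import Data.List.Membership.Propositional using (_∈_; _∉_)
open import Data.List.Membership.Propositional.Properties
  using (∈-++⁺ˡ; ∈-++⁺ʳ; ∈-++⁻; ∈-map⁺; ∈-map⁻; ∈-∃++; ∈-applyUpTo⁻)
open import Data.List.Membership.DecPropositional _≟_ using (_∈?_)
open import Data.List.Relation.Unary.Unique.Propositional using (Unique; []; _∷_)
open import Data.List.Relation.Unary.Unique.Propositional.Properties using (Unique[x∷xs]⇒x∉xs; applyUpTo⁺₁)
import Data.List.Relation.Unary.Unique.Propositional.Properties as Unique
open import Data.List.Relation.Binary.Disjoint.Propositional using (Disjoint)
open import Data.List.Relation.Binary.Permutation.Propositional using (_↭_; ↭⇒↭ₛ)
import Data.List.Relation.Binary.Permutation.Propositional as Perm
import Data.List.Relation.Binary.Permutation.Propositional.Properties as ↭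
import Data.List.Relation.Binary.Permutation.Setoid.Properties as ↭ₛ
open import Relation.Binary.PropositionalEquality
  using (_≡_; _≢_; refl; sym; trans; cong; cong₂; subst; subst₂; setoid; module ≡-Reasoning)
open import Relation.Nullary using (yes; no)
open import Function using (_∘_)
open import Function.Definitions using (Injective)
import Algebra.Solver.Monoid as MonoidSolver

-- Lists and fresh variables

module _ {A : Set} where

  private variable
    x v : A
    xs ys : List A

  Unique-∷ : x ∉ xs → Unique xs → Unique (x ∷ xs)
  Unique-∷ x∉xs u = ¬Any⇒All¬ _ x∉xs ∷ u

  Unique-tail : Unique (x ∷ xs) → Unique xs
  Unique-tail (_ ∷ u) = u

  Unique-++⁻ˡ : ∀ (xs : List A) → Unique (xs ++ ys) → Unique xs
  Unique-++⁻ˡ []       u = []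
  Unique-++⁻ˡ (x ∷ xs) u =
    Unique-∷ (λ x∈xs → Unique[x∷xs]⇒x∉xs u (∈-++⁺ˡ x∈xs)) (Unique-++⁻ˡ xs (Unique-tail u))

  Unique-++⁻ʳ : ∀ (xs : List A) → Unique (xs ++ ys) → Unique ys
  Unique-++⁻ʳ []       u = u
  Unique-++⁻ʳ (x ∷ xs) u = Unique-++⁻ʳ xs (Unique-tail u)

  Unique-++⇒Disjoint : ∀ (xs : List A) → Unique (xs ++ ys) → Disjoint xs ys
  Unique-++⇒Disjoint (x ∷ xs) u (here refl , v∈ys) = Unique[x∷xs]⇒x∉xs u (∈-++⁺ʳ xs v∈ys)
  Unique-++⇒Disjoint (x ∷ xs) u (there v∈xs , v∈ys) = Unique-++⇒Disjoint xs (Unique-tail u) (v∈xs , v∈ys)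

  ∈-drop : ∀ (xs ys zs : List A) {ws} → v ∈ xs ++ ys ++ zs ++ ws → v ∉ zs → v ∈ xs ++ ys ++ ws
  ∈-drop xs ys zs v∈ v∉zs with ∈-++⁻ xs v∈
  ... | inj₁ ∈xs = ∈-++⁺ˡ ∈xs
  ... | inj₂ v∈′ with ∈-++⁻ ys v∈′
  ...   | inj₁ ∈ys = ∈-++⁺ʳ xs (∈-++⁺ˡ ∈ys)
  ...   | inj₂ v∈″ with ∈-++⁻ zs v∈″
  ...     | inj₁ ∈zs = ⊥-elim (v∉zs ∈zs)
  ...     | inj₂ ∈ws = ∈-++⁺ʳ xs (∈-++⁺ʳ ys ∈ws)

  ∈-insert-middle : ∀ (xs ys : List A) {zs} → v ∈ xs ++ zs → v ∈ xs ++ ys ++ zs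
  ∈-insert-middle xs ys v∈ with ∈-++⁻ xs v∈
  ... | inj₁ ∈xs = ∈-++⁺ˡ ∈xs
  ... | inj₂ ∈zs = ∈-++⁺ʳ xs (∈-++⁺ʳ ys ∈zs)

freshVars : List Var → ℕ → List Var
freshVars xs = applyUpTo (suc (max 0 xs) +_)

module _ (xs : List Var) (n : ℕ) where

  length-freshVars : length (freshVars xs n) ≡ n
  length-freshVars = length-applyUpTo _ n

  freshVars-unique : Unique (freshVars xs n)
  freshVars-unique = applyUpTo⁺₁ _ n (λ i<j _ eq → <⇒≢ i<j (+-cancelˡ-≡ _ _ _ eq))

  freshVars-fresh : Disjoint (freshVars xs n) xs
  freshVars-fresh (v∈fresh , v∈xs) with ∈-applyUpTo⁻ _ v∈fresh
  ... | i , _ , refl = <-irrefl refl (≤-trans (s≤s (All.lookup (xs≤max 0 xs) v∈xs)) (m≤m+n _ i))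

transpose : List Var → List Var → Var → Var
transpose (x ∷ xs) (y ∷ ys) v with v ≟ x
... | yes _ = y
... | no _ with v ≟ y
...   | yes _ = x
...   | no _  = transpose xs ys v
transpose _ _ v = v

transpose-fix : ∀ {v} xs ys → v ∉ xs → v ∉ ys → transpose xs ys v ≡ v
transpose-fix []       _        _ _ = refl
transpose-fix (x ∷ xs) []       _ _ = refl
transpose-fix {v} (x ∷ xs) (y ∷ ys) v∉xs v∉ys with v ≟ x
... | yes v≡x = ⊥-elim (v∉xs (here v≡x))
... | no _ with v ≟ y
...   | yes v≡y = ⊥-elim (v∉ys (here v≡y))
...   | no _    = transpose-fix xs ys (v∉xs ∘ there) (v∉ys ∘ there)

transpose-∈ : ∀ {v} xs ys → length xs ≡ length ys → Disjoint xs ys → v ∈ xs → transpose xs ys v ∈ ys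
transpose-∈ {v} (x ∷ xs) (y ∷ ys) len xs#ys v∈ with v ≟ x
... | yes _ = here refl
... | no v≢x with v ≟ y
...   | yes refl = ⊥-elim (xs#ys (v∈ , here refl))
...   | no _ with v∈
...     | here v≡x = ⊥-elim (v≢x v≡x)
...     | there v∈xs = there (transpose-∈ xs ys (cong pred len) (λ (p , q) → xs#ys (there p , there q)) v∈xs)

transpose-moves-within : ∀ xs ys v → transpose xs ys v ≡ v ⊎ transpose xs ys v ∈ xs ++ ys
transpose-moves-within []       _        v = inj₁ refl
transpose-moves-within (x ∷ xs) []       v = inj₁ refl
transpose-moves-within (x ∷ xs) (y ∷ ys) v with v ≟ x
... | yes _ = inj₂ (there (∈-++⁺ʳ xs (here refl)))
... | no _ with v ≟ y
...   | yes _ = inj₂ (here refl)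
...   | no _ with transpose-moves-within xs ys v
...     | inj₁ fixed = inj₁ fixed
...     | inj₂ moved = inj₂ (there ([ ∈-++⁺ˡ , ∈-++⁺ʳ xs ∘ there ] (∈-++⁻ xs moved)))

private
  outside : ∀ {v w : Var} xs {ys} → w ≡ v ⊎ w ∈ xs ++ ys → w ≢ v → w ∉ xs → w ∉ ys → ⊥
  outside _  (inj₁ w≡v) w≢v _ _ = w≢v w≡v
  outside xs (inj₂ w∈) _ w∉xs w∉ys = [ w∉xs , w∉ys ] (∈-++⁻ xs w∈)

transpose-involutive : ∀ {xs ys} → Unique xs → Unique ys → Disjoint xs ys →
  ∀ v → transpose xs ys (transpose xs ys v) ≡ v
transpose-involutive {[]}     {_}      _ _ _ v = refl
transpose-involutive {x ∷ xs} {[]}     _ _ _ v = refl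
transpose-involutive {x ∷ xs} {y ∷ ys} ux uy x#y v with v ≟ x
... | yes refl with y ≟ v
...   | yes refl = ⊥-elim (x#y (here refl , here refl))
...   | no _ with y ≟ y
...     | yes _   = refl
...     | no y≢y = ⊥-elim (y≢y refl)
transpose-involutive {x ∷ xs} {y ∷ ys} ux uy x#y v | no v≢x with v ≟ y
... | yes refl with x ≟ x
...   | yes _   = refl
...   | no x≢x = ⊥-elim (x≢x refl)
transpose-involutive {x ∷ xs} {y ∷ ys} ux uy x#y v | no v≢x | no v≢y
  with transpose xs ys v | transpose-moves-within xs ys v
     | transpose-involutive (Unique-tail ux) (Unique-tail uy) (λ (p , q) → x#y (there p , there q)) v
... | w | w-within | involutive with w ≟ x
...   | yes refl = ⊥-elim (outside xs w-within (v≢x ∘ sym) (Unique[x∷xs]⇒x∉xs ux) (λ x∈ys → x#y (here refl , there x∈ys)))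
...   | no _ with w ≟ y
...     | yes refl = ⊥-elim (outside xs w-within (v≢y ∘ sym) (λ y∈xs → x#y (there y∈xs , here refl)) (Unique[x∷xs]⇒x∉xs uy))
...     | no _     = involutive

transpose-injective : ∀ {xs ys} → Unique xs → Unique ys → Disjoint xs ys → Injective _≡_ _≡_ (transpose xs ys)
transpose-injective {xs} {ys} ux uy xs#ys {v} {w} eq =
  trans (sym (transpose-involutive ux uy xs#ys v)) (trans (cong (transpose xs ys) eq) (transpose-involutive ux uy xs#ys w))

module RenameApart (S V : List Var) (S-unique : Unique S) where

  private
    F : List Var
    F = freshVars (V ++ S) (length S)

    S#F : Disjoint S F
    S#F (v∈S , v∈F) = freshVars-fresh (V ++ S) (length S) (v∈F , ∈-++⁺ʳ V v∈S)

  apart : Var → Var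
  apart = transpose S F

  apart-involutive : ∀ v → apart (apart v) ≡ v
  apart-involutive = transpose-involutive S-unique (freshVars-unique (V ++ S) (length S)) S#F

  apart-injective : Injective _≡_ _≡_ apart
  apart-injective = transpose-injective S-unique (freshVars-unique (V ++ S) (length S)) S#F

  apart-∉ : ∀ {v} → v ∈ S → apart v ∉ V
  apart-∉ v∈S ρv∈V = freshVars-fresh (V ++ S) (length S)
    (transpose-∈ S F (sym (length-freshVars (V ++ S) (length S))) S#F v∈S , ∈-++⁺ˡ ρv∈V)

  apart-fix : ∀ {v} → v ∉ S → v ∈ V → apart v ≡ v
  apart-fix v∉S v∈V = transpose-fix S F v∉S (λ v∈F → freshVars-fresh (V ++ S) (length S) (v∈F , ∈-++⁺ˡ v∈V))

transpose-head : ∀ {x y : Var} xs ys → transpose (x ∷ xs) (y ∷ ys) x ≡ y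
transpose-head {x} xs ys with x ≟ x
... | yes _   = refl
... | no x≢x = ⊥-elim (x≢x refl)

-- Terms and substitution

module Terms (Σ : Signature) where
  open Signature Σ
  open Syntax Σ

  lookupSub : Sub → Var → ATerm
  lookupSub []            x = var x
  lookupSub ((y , s) ∷ σ) x with x ≟ y
  ... | yes _ = s
  ... | no _  = lookupSub σ x

  lookupVar≡lookupSub : ∀ σ x → lookupVar σ x ≡ lookupSub σ x ∷ []
  lookupVar≡lookupSub []            x = refl
  lookupVar≡lookupSub ((y , s) ∷ σ) x with x ≟ y
  ... | yes _ = refl
  ... | no _  = lookupVar≡lookupSub σ x

  mutual
    bindA : (Var → ATerm) → ATerm → ATerm
    bindA φ (var x)    = φ x
    bindA φ (app f ts) = app f (bindTs φ ts)

    bindT : (Var → ATerm) → Term → Term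
    bindT φ []      = []
    bindT φ (a ∷ t) = bindA φ a ∷ bindT φ t

    bindTs : (Var → ATerm) → List Term → List Term
    bindTs φ []       = []
    bindTs φ (t ∷ ts) = bindT φ t ∷ bindTs φ ts

  mutual
    substA≡bindA : ∀ σ a → substA σ a ≡ bindA (lookupSub σ) a ∷ []
    substA≡bindA σ (var x)    = lookupVar≡lookupSub σ x
    substA≡bindA σ (app f ts) = cong (λ ts′ → app f ts′ ∷ []) (substTs≡bindTs σ ts)

    substT≡bindT : ∀ σ t → substT σ t ≡ bindT (lookupSub σ) t
    substT≡bindT σ []      = refl
    substT≡bindT σ (a ∷ t) = cong₂ _++_ (substA≡bindA σ a) (substT≡bindT σ t)

    substTs≡bindTs : ∀ σ ts → substTs σ ts ≡ bindTs (lookupSub σ) ts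
    substTs≡bindTs σ []       = refl
    substTs≡bindTs σ (t ∷ ts) = cong₂ _∷_ (substT≡bindT σ t) (substTs≡bindTs σ ts)

  mutual
    bindA-∘ : ∀ φ ψ a → bindA φ (bindA ψ a) ≡ bindA (bindA φ ∘ ψ) a
    bindA-∘ φ ψ (var x)    = refl
    bindA-∘ φ ψ (app f ts) = cong (app f) (bindTs-∘ φ ψ ts)

    bindT-∘ : ∀ φ ψ t → bindT φ (bindT ψ t) ≡ bindT (bindA φ ∘ ψ) t
    bindT-∘ φ ψ []      = refl
    bindT-∘ φ ψ (a ∷ t) = cong₂ _∷_ (bindA-∘ φ ψ a) (bindT-∘ φ ψ t)

    bindTs-∘ : ∀ φ ψ ts → bindTs φ (bindTs ψ ts) ≡ bindTs (bindA φ ∘ ψ) ts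
    bindTs-∘ φ ψ []       = refl
    bindTs-∘ φ ψ (t ∷ ts) = cong₂ _∷_ (bindT-∘ φ ψ t) (bindTs-∘ φ ψ ts)

  mutual
    bindA-var : ∀ a → bindA var a ≡ a
    bindA-var (var x)    = refl
    bindA-var (app f ts) = cong (app f) (bindTs-var ts)

    bindT-var : ∀ t → bindT var t ≡ t
    bindT-var []      = refl
    bindT-var (a ∷ t) = cong₂ _∷_ (bindA-var a) (bindT-var t)

    bindTs-var : ∀ ts → bindTs var ts ≡ ts
    bindTs-var []       = refl
    bindTs-var (t ∷ ts) = cong₂ _∷_ (bindT-var t) (bindTs-var ts)

  mutual
    bindA-cong : ∀ {φ ψ} a → (∀ v → φ v ≡ ψ v) → bindA φ a ≡ bindA ψ a
    bindA-cong (var x)    φ≗ψ = φ≗ψ x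
    bindA-cong (app f ts) φ≗ψ = cong (app f) (bindTs-cong ts φ≗ψ)

    bindT-cong : ∀ {φ ψ} t → (∀ v → φ v ≡ ψ v) → bindT φ t ≡ bindT ψ t
    bindT-cong []      φ≗ψ = refl
    bindT-cong (a ∷ t) φ≗ψ = cong₂ _∷_ (bindA-cong a φ≗ψ) (bindT-cong t φ≗ψ)

    bindTs-cong : ∀ {φ ψ} ts → (∀ v → φ v ≡ ψ v) → bindTs φ ts ≡ bindTs ψ ts
    bindTs-cong []       φ≗ψ = refl
    bindTs-cong (t ∷ ts) φ≗ψ = cong₂ _∷_ (bindT-cong t φ≗ψ) (bindTs-cong ts φ≗ψ)

  bindT-++ : ∀ φ s t → bindT φ (s ++ t) ≡ bindT φ s ++ bindT φ t
  bindT-++ φ []      t = refl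
  bindT-++ φ (a ∷ s) t = cong (bindA φ a ∷_) (bindT-++ φ s t)

  bindT≡map : ∀ φ t → bindT φ t ≡ map (bindA φ) t
  bindT≡map φ []      = refl
  bindT≡map φ (a ∷ t) = cong (bindA φ a ∷_) (bindT≡map φ t)

  length-bindT : ∀ φ t → length (bindT φ t) ≡ length t
  length-bindT φ []      = refl
  length-bindT φ (a ∷ t) = cong suc (length-bindT φ t)

  mutual
    ScopedA : List Var → ATerm → Set
    ScopedA xs (var x)    = x ∈ xs
    ScopedA xs (app f ts) = ScopedTs xs ts

    ScopedT : List Var → Term → Set
    ScopedT xs []      = ⊤
    ScopedT xs (a ∷ t) = ScopedA xs a × ScopedT xs t

    ScopedTs : List Var → List Term → Set
    ScopedTs xs []       = ⊤
    ScopedTs xs (t ∷ ts) = ScopedT xs t × ScopedTs xs ts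

  mutual
    bindA-cong-on : ∀ {xs φ ψ} a → ScopedA xs a → (∀ {v} → v ∈ xs → φ v ≡ ψ v) → bindA φ a ≡ bindA ψ a
    bindA-cong-on (var x)    x∈ φ≡ψ = φ≡ψ x∈
    bindA-cong-on (app f ts) sc φ≡ψ = cong (app f) (bindTs-cong-on ts sc φ≡ψ)

    bindT-cong-on : ∀ {xs φ ψ} t → ScopedT xs t → (∀ {v} → v ∈ xs → φ v ≡ ψ v) → bindT φ t ≡ bindT ψ t
    bindT-cong-on []      _          φ≡ψ = refl
    bindT-cong-on (a ∷ t) (sa , st) φ≡ψ = cong₂ _∷_ (bindA-cong-on a sa φ≡ψ) (bindT-cong-on t st φ≡ψ)

    bindTs-cong-on : ∀ {xs φ ψ} ts → ScopedTs xs ts → (∀ {v} → v ∈ xs → φ v ≡ ψ v) → bindTs φ ts ≡ bindTs ψ ts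
    bindTs-cong-on []       _          φ≡ψ = refl
    bindTs-cong-on (t ∷ ts) (st , sts) φ≡ψ = cong₂ _∷_ (bindT-cong-on t st φ≡ψ) (bindTs-cong-on ts sts φ≡ψ)

  bindA-id-on : ∀ {xs φ} a → ScopedA xs a → (∀ {v} → v ∈ xs → φ v ≡ var v) → bindA φ a ≡ a
  bindA-id-on a sc φ≡var = trans (bindA-cong-on a sc φ≡var) (bindA-var a)

  bindT-id-on : ∀ {xs φ} t → ScopedT xs t → (∀ {v} → v ∈ xs → φ v ≡ var v) → bindT φ t ≡ t
  bindT-id-on t sc φ≡var = trans (bindT-cong-on t sc φ≡var) (bindT-var t)

  mutual
    ScopedA-bind : ∀ {xs ys φ} a → ScopedA xs a → (∀ {v} → v ∈ xs → ScopedA ys (φ v)) → ScopedA ys (bindA φ a)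
    ScopedA-bind (var x)    x∈ scφ = scφ x∈
    ScopedA-bind (app f ts) sc scφ = ScopedTs-bind ts sc scφ

    ScopedT-bind : ∀ {xs ys φ} t → ScopedT xs t → (∀ {v} → v ∈ xs → ScopedA ys (φ v)) → ScopedT ys (bindT φ t)
    ScopedT-bind []      _         scφ = tt
    ScopedT-bind (a ∷ t) (sa , st) scφ = ScopedA-bind a sa scφ , ScopedT-bind t st scφ

    ScopedTs-bind : ∀ {xs ys φ} ts → ScopedTs xs ts → (∀ {v} → v ∈ xs → ScopedA ys (φ v)) → ScopedTs ys (bindTs φ ts)
    ScopedTs-bind []       _          scφ = tt
    ScopedTs-bind (t ∷ ts) (st , sts) scφ = ScopedT-bind t st scφ , ScopedTs-bind ts sts scφ

  ScopedT-⊆ : ∀ {xs ys} t → (∀ {v} → v ∈ xs → v ∈ ys) → ScopedT xs t → ScopedT ys t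
  ScopedT-⊆ t xs⊆ys sc = subst (ScopedT _) (bindT-var t) (ScopedT-bind t sc xs⊆ys)

  ScopedTs-⊆ : ∀ {xs ys} ts → (∀ {v} → v ∈ xs → v ∈ ys) → ScopedTs xs ts → ScopedTs ys ts
  ScopedTs-⊆ ts xs⊆ys sc = subst (ScopedTs _) (bindTs-var ts) (ScopedTs-bind ts sc xs⊆ys)

  ScopedT-++ : ∀ {xs} s t → ScopedT xs s → ScopedT xs t → ScopedT xs (s ++ t)
  ScopedT-++ []      t _          sct = sct
  ScopedT-++ (a ∷ s) t (sa , scs) sct = sa , ScopedT-++ s t scs sct

  infix 4 _↦_
  _↦_ : List Var → Term → Var → ATerm
  xs ↦ s = lookupSub (zip xs s)

  ↦-here : ∀ y ys a s → (y ∷ ys ↦ a ∷ s) y ≡ a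
  ↦-here y ys a s with y ≟ y
  ... | yes _   = refl
  ... | no y≢y = ⊥-elim (y≢y refl)

  ↦-there : ∀ {x} y ys a s → x ≢ y → (y ∷ ys ↦ a ∷ s) x ≡ (ys ↦ s) x
  ↦-there {x} y ys a s x≢y with x ≟ y
  ... | yes x≡y = ⊥-elim (x≢y x≡y)
  ... | no _    = refl

  ↦-∉ : ∀ {x} xs s → x ∉ xs → (xs ↦ s) x ≡ var x
  ↦-∉ []       s       _   = refl
  ↦-∉ (y ∷ ys) []      _   = refl
  ↦-∉ {x} (y ∷ ys) (a ∷ s) x∉ with x ≟ y
  ... | yes x≡y = ⊥-elim (x∉ (here x≡y))
  ... | no _    = ↦-∉ ys s (x∉ ∘ there)

  ↦-++-∈ : ∀ {x ys t} xs s → length xs ≡ length s → x ∈ xs → (xs ++ ys ↦ s ++ t) x ≡ (xs ↦ s) x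
  ↦-++-∈ {x} (y ∷ xs) (a ∷ s) len x∈ with x ≟ y
  ... | yes _ = refl
  ↦-++-∈ (y ∷ xs) (a ∷ s) len (here x≡y)  | no x≢y = ⊥-elim (x≢y x≡y)
  ↦-++-∈ (y ∷ xs) (a ∷ s) len (there x∈) | no _   = ↦-++-∈ xs s (suc-injective len) x∈

  ↦-++-∉ : ∀ {x ys t} xs s → length xs ≡ length s → x ∉ xs → (xs ++ ys ↦ s ++ t) x ≡ (ys ↦ t) x
  ↦-++-∉ []       []      len x∉ = refl
  ↦-++-∉ {x} (y ∷ xs) (a ∷ s) len x∉ with x ≟ y
  ... | yes x≡y = ⊥-elim (x∉ (here x≡y))
  ... | no _    = ↦-++-∉ xs s (suc-injective len) (x∉ ∘ there)

  ↦-scoped : ∀ {zs x} xs s → ScopedT zs s → length xs ≡ length s → x ∈ xs → ScopedA zs ((xs ↦ s) x)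
  ↦-scoped {x = x} (y ∷ xs) (a ∷ s) (sa , scs) len x∈ with x ≟ y
  ... | yes _ = sa
  ↦-scoped (y ∷ xs) (a ∷ s) (sa , scs) len (here x≡y)  | no x≢y = ⊥-elim (x≢y x≡y)
  ↦-scoped (y ∷ xs) (a ∷ s) (sa , scs) len (there x∈) | no _   = ↦-scoped xs s scs (suc-injective len) x∈

  ↦-var : ∀ {x} xs ys → length xs ≡ length ys → x ∈ xs → ∃[ w ] w ∈ ys × (xs ↦ map var ys) x ≡ var w
  ↦-var {x} (y ∷ xs) (w ∷ ys) len x∈ with x ≟ y
  ... | yes _ = w , here refl , refl
  ↦-var (y ∷ xs) (w ∷ ys) len (here x≡y) | no x≢y = ⊥-elim (x≢y x≡y)
  ↦-var (y ∷ xs) (w ∷ ys) len (there x∈) | no _ with ↦-var xs ys (suc-injective len) x∈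
  ... | w′ , w′∈ , eq = w′ , there w′∈ , eq

  ↦-++-sequential : ∀ {V} xs₁ xs₂ s₁ s₂ → length xs₁ ≡ length s₁ → ScopedT V s₁ → Disjoint V xs₂ →
    ∀ v → bindA (xs₂ ↦ s₂) ((xs₁ ↦ s₁) v) ≡ (xs₁ ++ xs₂ ↦ s₁ ++ s₂) v
  ↦-++-sequential xs₁ xs₂ s₁ s₂ len sc V#xs₂ v with v ∈? xs₁
  ... | yes v∈ = trans (bindA-id-on _ (↦-scoped xs₁ s₁ sc len v∈) (λ w∈V → ↦-∉ xs₂ s₂ (λ w∈xs₂ → V#xs₂ (w∈V , w∈xs₂))))
                   (sym (↦-++-∈ xs₁ s₁ len v∈))
  ... | no v∉ = trans (cong (bindA (xs₂ ↦ s₂)) (↦-∉ xs₁ s₁ v∉)) (sym (↦-++-∉ xs₁ s₁ len v∉))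

  [/]≡bindT : ∀ t s xs → t [ s / xs ] ≡ bindT (xs ↦ s) t
  [/]≡bindT t s xs = substT≡bindT (zip xs s) t

  ↦-rename : ∀ (ρ : Var → Var) → Injective _≡_ _≡_ ρ → ∀ xs ys x →
    (map ρ xs ↦ map var (map ρ ys)) (ρ x) ≡ bindA (var ∘ ρ) ((xs ↦ map var ys) x)
  ↦-rename ρ inj []       ys       x = refl
  ↦-rename ρ inj (y ∷ xs) []       x = refl
  ↦-rename ρ inj (y ∷ xs) (w ∷ ys) x with ρ x ≟ ρ y | x ≟ y
  ... | yes _     | yes _   = refl
  ... | yes ρx≡ρy | no x≢y  = ⊥-elim (x≢y (inj ρx≡ρy))
  ... | no ρx≢ρy  | yes x≡y = ⊥-elim (ρx≢ρy (cong ρ x≡y))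
  ... | no _      | no _    = ↦-rename ρ inj xs ys x

  ↦-prefix : ∀ {x ys t} xs s → length xs ≡ length s → x ∉ xs → (xs ++ ys ↦ map var s ++ t) x ≡ (ys ↦ t) x
  ↦-prefix xs s len x∉ = ↦-++-∉ xs (map var s) (trans len (sym (length-map var s))) x∉

  ↦-head-block : ∀ {xs zs} ys s → Unique ys → length ys ≡ length s → map (ys ++ xs ↦ s ++ zs) ys ≡ s
  ↦-head-block []       []      _ _   = refl
  ↦-head-block {xs} {zs} (y ∷ ys) (a ∷ s) u len =
    cong₂ _∷_ (↦-here y (ys ++ xs) a (s ++ zs))
      (trans (map-cong-local (All.tabulate skip-y)) (↦-head-block ys s (Unique-tail u) (suc-injective len)))
    where
    skip-y : ∀ {q} → q ∈ ys → (y ∷ ys ++ xs ↦ a ∷ s ++ zs) q ≡ (ys ++ xs ↦ s ++ zs) q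
    skip-y {q} q∈ = ↦-there {q} y (ys ++ xs) a _ (λ { refl → Unique[x∷xs]⇒x∉xs u q∈ })

  ↦-block : ∀ xs₁ ys xs₂ zs₁ ws zs₂ → Disjoint xs₁ ys → Unique ys →
    length xs₁ ≡ length zs₁ → length ys ≡ length ws →
    map (xs₁ ++ ys ++ xs₂ ↦ map var (zs₁ ++ ws ++ zs₂)) ys ≡ map var ws
  ↦-block xs₁ ys xs₂ zs₁ ws zs₂ xs₁#ys u len₁ len = begin
    map (xs₁ ++ ys ++ xs₂ ↦ map var (zs₁ ++ ws ++ zs₂)) ys
      ≡⟨ cong (λ s → map (xs₁ ++ ys ++ xs₂ ↦ s) ys) (map-++ var zs₁ _) ⟩
    map (xs₁ ++ ys ++ xs₂ ↦ map var zs₁ ++ map var (ws ++ zs₂)) ys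
      ≡⟨ map-cong-local (All.tabulate (λ q∈ys → ↦-prefix xs₁ zs₁ len₁ (λ q∈xs₁ → xs₁#ys (q∈xs₁ , q∈ys)))) ⟩
    map (ys ++ xs₂ ↦ map var (ws ++ zs₂)) ys
      ≡⟨ cong (λ s → map (ys ++ xs₂ ↦ s) ys) (map-++ var ws zs₂) ⟩
    map (ys ++ xs₂ ↦ map var ws ++ map var zs₂) ys
      ≡⟨ ↦-head-block ys (map var ws) u (trans len (sym (length-map var ws))) ⟩
    map var ws ∎
    where open ≡-Reasoning

  ↦-replace-middle : ∀ {x} xs₁ ys ys′ xs₂ s₁ t t′ s₂ →
    length xs₁ ≡ length s₁ → length ys ≡ length t → length ys′ ≡ length t′ → x ∉ ys → x ∉ ys′ →
    (xs₁ ++ ys ++ xs₂ ↦ s₁ ++ t ++ s₂) x ≡ (xs₁ ++ ys′ ++ xs₂ ↦ s₁ ++ t′ ++ s₂) x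
  ↦-replace-middle {x} xs₁ ys ys′ xs₂ s₁ t t′ s₂ len₁ len len′ x∉ys x∉ys′ with x ∈? xs₁
  ... | yes x∈ = trans (↦-++-∈ xs₁ s₁ len₁ x∈) (sym (↦-++-∈ xs₁ s₁ len₁ x∈))
  ... | no x∉ = begin
    (xs₁ ++ ys ++ xs₂ ↦ s₁ ++ t ++ s₂) x    ≡⟨ ↦-++-∉ xs₁ s₁ len₁ x∉ ⟩
    (ys ++ xs₂ ↦ t ++ s₂) x                 ≡⟨ ↦-++-∉ ys t len x∉ys ⟩
    (xs₂ ↦ s₂) x                            ≡⟨ ↦-++-∉ ys′ t′ len′ x∉ys′ ⟨
    (ys′ ++ xs₂ ↦ t′ ++ s₂) x               ≡⟨ ↦-++-∉ xs₁ s₁ len₁ x∉ ⟨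
    (xs₁ ++ ys′ ++ xs₂ ↦ s₁ ++ t′ ++ s₂) x  ∎
    where open ≡-Reasoning

  ↦-renaming : ∀ xs zs v → length xs ≡ length zs → ∃[ w ] (w ≡ v ⊎ w ∈ zs) × (xs ↦ map var zs) v ≡ var w
  ↦-renaming xs zs v len with v ∈? xs
  ... | no v∉ = v , inj₁ refl , ↦-∉ xs _ v∉
  ... | yes v∈ with ↦-var xs zs len v∈
  ...   | w , w∈ , eq = w , inj₂ w∈ , eq

  ↦-rename-domain : ∀ (ρ : Var → Var) → Injective _≡_ _≡_ ρ → ∀ xs s {x} → x ∈ xs → length xs ≡ length s →
    (map ρ xs ↦ s) (ρ x) ≡ (xs ↦ s) x
  ↦-rename-domain ρ inj (y ∷ xs) (a ∷ s) {x} x∈ len with ρ x ≟ ρ y | x ≟ y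
  ... | yes _     | yes _   = refl
  ... | yes ρx≡ρy | no x≢y  = ⊥-elim (x≢y (inj ρx≡ρy))
  ... | no ρx≢ρy  | yes x≡y = ⊥-elim (ρx≢ρy (cong ρ x≡y))
  ↦-rename-domain ρ inj (y ∷ xs) (a ∷ s) (here x≡y)  len | no _ | no x≢y = ⊥-elim (x≢y x≡y)
  ↦-rename-domain ρ inj (y ∷ xs) (a ∷ s) (there x∈) len | no _ | no _   = ↦-rename-domain ρ inj xs s x∈ (suc-injective len)

  ↦-bind : ∀ ψ xs s x → length xs ≡ length s → (x ∉ xs → ψ x ≡ var x) → (xs ↦ map (bindA ψ) s) x ≡ bindA ψ ((xs ↦ s) x)
  ↦-bind ψ []       []      x _   x∉→ = sym (x∉→ (λ ()))
  ↦-bind ψ (y ∷ xs) (a ∷ s) x len x∉→ with x ≟ y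
  ... | yes _   = refl
  ... | no x≢y = ↦-bind ψ xs s x (suc-injective len) (λ x∉ → x∉→ (λ { (here x≡y) → x≢y x≡y ; (there x∈) → x∉ x∈ }))

-- Substitution-free derivations

module _ (L : Language) where
  open Language L
  open Calculus L
  open Terms sig
  open MonoidSolver (++-monoid (Var × Sort)) using (solve; _⊜_; _⊕_)

  infix 3 _⊢_∶_
  _⊢_∶_ : Ctx → Term → Type → Set
  Γ ⊢ t ∶ B = Γ ⊢[ false ] t ∶ B

  Distinct : Ctx → Set
  Distinct Γ = Unique (vars Γ)

  vars-++ : ∀ Γ Δ → vars (Γ ++ Δ) ≡ vars Γ ++ vars Δ
  vars-++ = map-++ proj₁

  vars-++³ : ∀ Γ Δ Θ → vars (Γ ++ Δ ++ Θ) ≡ vars Γ ++ vars Δ ++ vars Θ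
  vars-++³ Γ Δ Θ = trans (vars-++ Γ _) (cong (vars Γ ++_) (vars-++ Δ Θ))

  vars-++⁴ : ∀ Γ Δ Θ Ξ → vars (Γ ++ Δ ++ Θ ++ Ξ) ≡ vars Γ ++ vars Δ ++ vars Θ ++ vars Ξ
  vars-++⁴ Γ Δ Θ Ξ = trans (vars-++ Γ _) (cong (vars Γ ++_) (vars-++³ Δ Θ Ξ))

  types-++ : ∀ Γ Δ → types (Γ ++ Δ) ≡ types Γ ++ types Δ
  types-++ = map-++ proj₂

  types-++³ : ∀ Γ Δ Θ → types (Γ ++ Δ ++ Θ) ≡ types Γ ++ types Δ ++ types Θ
  types-++³ Γ Δ Θ = trans (types-++ Γ _) (cong (types Γ ++_) (types-++ Δ Θ))

  length-vars : ∀ Γ → length (vars Γ) ≡ length (types Γ)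
  length-vars Γ = trans (length-map proj₁ Γ) (sym (length-map proj₂ Γ))

  module _ {v : Var} where

    ∈vars-++⁺ˡ : ∀ Γ Δ → v ∈ vars Γ → v ∈ vars (Γ ++ Δ)
    ∈vars-++⁺ˡ Γ Δ v∈ = subst (v ∈_) (sym (vars-++ Γ Δ)) (∈-++⁺ˡ v∈)

    ∈vars-++⁺ʳ : ∀ Γ Δ → v ∈ vars Δ → v ∈ vars (Γ ++ Δ)
    ∈vars-++⁺ʳ Γ Δ v∈ = subst (v ∈_) (sym (vars-++ Γ Δ)) (∈-++⁺ʳ (vars Γ) v∈)

    ∈vars-++⁻ : ∀ Γ Δ → v ∈ vars (Γ ++ Δ) → v ∈ vars Γ ⊎ v ∈ vars Δ
    ∈vars-++⁻ Γ Δ v∈ = ∈-++⁻ (vars Γ) (subst (v ∈_) (vars-++ Γ Δ) v∈)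

    ∈vars-↭ : ∀ {Γ Δ} → Γ ↭ Δ → v ∈ vars Γ → v ∈ vars Δ
    ∈vars-↭ Γ↭Δ = ↭.∈-resp-↭ (↭.map⁺ proj₁ Γ↭Δ)

    ∈vars-middle : ∀ Γ Δ Θ → v ∈ vars (Γ ++ Θ) → v ∈ vars (Γ ++ Δ ++ Θ)
    ∈vars-middle Γ Δ Θ v∈ =
      [ ∈vars-++⁺ˡ Γ _ , ∈vars-++⁺ʳ Γ _ ∘ ∈vars-++⁺ʳ Δ Θ ] (∈vars-++⁻ Γ Θ v∈)

  Distinct-++⁻ˡ : ∀ Γ {Δ} → Distinct (Γ ++ Δ) → Distinct Γ
  Distinct-++⁻ˡ Γ {Δ} u = Unique-++⁻ˡ (vars Γ) (subst Unique (vars-++ Γ Δ) u)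

  Distinct-++⁻ʳ : ∀ Γ {Δ} → Distinct (Γ ++ Δ) → Distinct Δ
  Distinct-++⁻ʳ Γ {Δ} u = Unique-++⁻ʳ (vars Γ) (subst Unique (vars-++ Γ Δ) u)

  Distinct-++⇒Disjoint : ∀ Γ {Δ} → Distinct (Γ ++ Δ) → Disjoint (vars Γ) (vars Δ)
  Distinct-++⇒Disjoint Γ {Δ} u = Unique-++⇒Disjoint (vars Γ) (subst Unique (vars-++ Γ Δ) u)

  Distinct-++⁺ : ∀ {Γ Δ} → Distinct Γ → Distinct Δ → Disjoint (vars Γ) (vars Δ) → Distinct (Γ ++ Δ)
  Distinct-++⁺ {Γ} {Δ} uΓ uΔ Γ#Δ = subst Unique (sym (vars-++ Γ Δ)) (Unique.++⁺ uΓ uΔ Γ#Δ)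

  Distinct-↭ : ∀ {Γ Δ} → Γ ↭ Δ → Distinct Γ → Distinct Δ
  Distinct-↭ Γ↭Δ = ↭ₛ.Unique-resp-↭ (setoid Var) (↭⇒↭ₛ (↭.map⁺ proj₁ Γ↭Δ))

  Distinct-drop-middle : ∀ Γ Δ Θ → Distinct (Γ ++ Δ ++ Θ) → Distinct (Γ ++ Θ)
  Distinct-drop-middle Γ Δ Θ u = Distinct-++⁻ʳ Δ (Distinct-↭ (↭.shifts Γ Δ) u)

  length-vars-≡ : ∀ {Γ Δ} → types Γ ≡ types Δ → length (vars Γ) ≡ length (vars Δ)
  length-vars-≡ {Γ} {Δ} eq = trans (length-vars Γ) (trans (cong length eq) (sym (length-vars Δ)))

  Distinct-contract : ∀ Γ₁ Δ Δ′ Γ₂ → Distinct (Γ₁ ++ Δ ++ Δ′ ++ Γ₂) → Distinct (Γ₁ ++ Δ ++ Γ₂)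
  Distinct-contract Γ₁ Δ Δ′ Γ₂ u =
    subst Distinct (++-assoc Γ₁ Δ Γ₂)
      (Distinct-drop-middle (Γ₁ ++ Δ) Δ′ Γ₂ (subst Distinct (sym (++-assoc Γ₁ Δ (Δ′ ++ Γ₂))) u))

  ∈vars-contract : ∀ Γ₁ Δ Δ′ Γ₂ {v} → v ∈ vars (Γ₁ ++ Δ ++ Δ′ ++ Γ₂) → v ∉ vars Δ′ → v ∈ vars (Γ₁ ++ Δ ++ Γ₂)
  ∈vars-contract Γ₁ Δ Δ′ Γ₂ v∈ v∉Δ′ =
    subst (_ ∈_) (sym (vars-++³ Γ₁ Δ Γ₂)) (∈-drop (vars Γ₁) (vars Δ) (vars Δ′) (subst (_ ∈_) (vars-++⁴ Γ₁ Δ Δ′ Γ₂) v∈) v∉Δ′)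

  contraction-scoped : ∀ Γ₁ Δ Δ′ Γ₂ → types Δ ≡ types Δ′ → ∀ {v} → v ∈ vars (Γ₁ ++ Δ ++ Δ′ ++ Γ₂) →
    ScopedA (vars (Γ₁ ++ Δ ++ Γ₂)) ((vars Δ′ ↦ map var (vars Δ)) v)
  contraction-scoped Γ₁ Δ Δ′ Γ₂ ty {v} v∈ with v ∈? vars Δ′
  ... | no v∉Δ′ = subst (ScopedA _) (sym (↦-∉ (vars Δ′) _ v∉Δ′)) (∈vars-contract Γ₁ Δ Δ′ Γ₂ v∈ v∉Δ′)
  ... | yes v∈Δ′ with ↦-var (vars Δ′) (vars Δ) (length-vars-≡ (sym ty)) v∈Δ′
  ...   | w , w∈Δ , eq = subst (ScopedA _) (sym eq) (∈vars-++⁺ʳ Γ₁ _ (∈vars-++⁺ˡ Δ Γ₂ w∈Δ))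

  ⊢-distinct : ∀ {Γ t B} → Γ ⊢ t ∶ B → Distinct Γ
  ⊢-distinct (variable′ x A)                            = Unique-∷ (λ ()) []
  ⊢-distinct (function f args u)                        = u
  ⊢-distinct (substitution () _ _ _)
  ⊢-distinct unit                                       = []
  ⊢-distinct (tensor d e u)                             = u
  ⊢-distinct (weaken _ d u)                             = u
  ⊢-distinct (exch _ d Γ↭Γ′)                            = Distinct-↭ Γ↭Γ′ (⊢-distinct d)
  ⊢-distinct (contract {Γ₁ = Γ₁} {Δ} {Δ′} {Γ₂} _ _ d) = Distinct-contract Γ₁ Δ Δ′ Γ₂ (⊢-distinct d)

  ⊢-length : ∀ {Γ t B} → Γ ⊢ t ∶ B → length t ≡ length B
  ⊢-length (variable′ x A)         = refl
  ⊢-length (function f _ _)        = refl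
  ⊢-length (substitution () _ _ _)
  ⊢-length unit                    = refl
  ⊢-length (tensor {s = s} {t} {B} {D} d e _) =
    trans (length-++ s) (trans (cong₂ _+_ (⊢-length d) (⊢-length e)) (sym (length-++ B)))
  ⊢-length (weaken _ d _)          = ⊢-length d
  ⊢-length (exch _ d _)            = ⊢-length d
  ⊢-length (contract {Δ = Δ} {Δ′} {t = t} _ _ d) =
    trans (cong length ([/]≡bindT t _ (vars Δ′))) (trans (length-bindT _ t) (⊢-length d))

  mutual
    ⊢-scoped : ∀ {Γ t B} → Γ ⊢ t ∶ B → ScopedT (vars Γ) t
    ⊢-scoped (variable′ x A)         = here refl , tt
    ⊢-scoped (function f args _)     = ⊢-scopedArgs args , tt
    ⊢-scoped (substitution () _ _ _)
    ⊢-scoped unit                    = tt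
    ⊢-scoped (tensor {Γ = Γ} {Δ} {s} {t} d e _) =
      ScopedT-++ s t (ScopedT-⊆ s (∈vars-++⁺ˡ Γ Δ) (⊢-scoped d)) (ScopedT-⊆ t (∈vars-++⁺ʳ Γ Δ) (⊢-scoped e))
    ⊢-scoped (weaken {Γ₁ = Γ₁} {Γ₂} {Γ₃} {t} _ d _) = ScopedT-⊆ t (∈vars-middle Γ₁ Γ₂ Γ₃) (⊢-scoped d)
    ⊢-scoped (exch {t = t} _ d Γ↭Γ′) = ScopedT-⊆ t (∈vars-↭ Γ↭Γ′) (⊢-scoped d)
    ⊢-scoped (contract {Γ₁ = Γ₁} {Δ} {Δ′} {Γ₂} {t} _ ty d) =
      subst (ScopedT _) (sym ([/]≡bindT t _ (vars Δ′)))
        (ScopedT-bind t (⊢-scoped d) (contraction-scoped Γ₁ Δ Δ′ Γ₂ ty))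

    ⊢-scopedArgs : ∀ {Γs ts Bs} → Args false Γs ts Bs → ScopedTs (vars (concat Γs)) ts
    ⊢-scopedArgs []                              = tt
    ⊢-scopedArgs (_∷_ {Γ} {t} {Γs = Γs} d args) =
      ScopedT-⊆ t (∈vars-++⁺ˡ Γ (concat Γs)) (⊢-scoped d) ,
      ScopedTs-⊆ _ (∈vars-++⁺ʳ Γ (concat Γs)) (⊢-scopedArgs args)

  -- Fresh variables must avoid all variables of a derivation, not only those of its conclusion,
  -- since contraction discards variables.
  mutual
    allVars : ∀ {Γ t B} → Γ ⊢ t ∶ B → List Var
    allVars {Γ} d = vars Γ ++ premiseVars d

    premiseVars : ∀ {Γ t B} → Γ ⊢ t ∶ B → List Var
    premiseVars (variable′ x A)         = []
    premiseVars (function f args u)     = argsVars args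
    premiseVars (substitution () _ _ _)
    premiseVars unit                    = []
    premiseVars (tensor d e u)          = allVars d ++ allVars e
    premiseVars (weaken _ d u)          = allVars d
    premiseVars (exch _ d p)            = allVars d
    premiseVars (contract _ _ d)        = allVars d

    argsVars : ∀ {Γs ts Bs} → Args false Γs ts Bs → List Var
    argsVars []         = []
    argsVars (d ∷ args) = allVars d ++ argsVars args

  mutual
    contractions : ∀ {Γ t B} → Γ ⊢ t ∶ B → ℕ
    contractions (variable′ x A)         = 0
    contractions (function f args u)     = argsContractions args
    contractions (substitution () _ _ _)
    contractions unit                    = 0
    contractions (tensor d e u)          = contractions d + contractions e
    contractions (weaken _ d u)          = contractions d
    contractions (exch _ d p)            = contractions d
    contractions (contract _ _ d)        = suc (contractions d)

    argsContractions : ∀ {Γs ts Bs} → Args false Γs ts Bs → ℕ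
    argsContractions []         = 0
    argsContractions (d ∷ args) = contractions d + argsContractions args

  castCtx : ∀ {Γ Γ′ t B} → Γ ≡ Γ′ → Γ ⊢ t ∶ B → Γ′ ⊢ t ∶ B
  castCtx refl d = d

  castTerm : ∀ {Γ t t′ B} → t ≡ t′ → Γ ⊢ t ∶ B → Γ ⊢ t′ ∶ B
  castTerm refl d = d

  contractions-castCtx : ∀ {Γ Γ′ t B} (eq : Γ ≡ Γ′) (d : Γ ⊢ t ∶ B) → contractions (castCtx eq d) ≡ contractions d
  contractions-castCtx refl d = refl

  renameCtx : (Var → Var) → Ctx → Ctx
  renameCtx ρ = map (map₁ ρ)

  renameCtx-++ : ∀ ρ Γ Δ → renameCtx ρ (Γ ++ Δ) ≡ renameCtx ρ Γ ++ renameCtx ρ Δ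
  renameCtx-++ ρ = map-++ (map₁ ρ)

  renameCtx-++³ : ∀ ρ Γ Δ Θ → renameCtx ρ (Γ ++ Δ ++ Θ) ≡ renameCtx ρ Γ ++ renameCtx ρ Δ ++ renameCtx ρ Θ
  renameCtx-++³ ρ Γ Δ Θ = trans (renameCtx-++ ρ Γ _) (cong (renameCtx ρ Γ ++_) (renameCtx-++ ρ Δ Θ))

  renameCtx-concat : ∀ ρ Γs → renameCtx ρ (concat Γs) ≡ concat (map (renameCtx ρ) Γs)
  renameCtx-concat ρ []       = refl
  renameCtx-concat ρ (Γ ∷ Γs) = trans (renameCtx-++ ρ Γ (concat Γs)) (cong (renameCtx ρ Γ ++_) (renameCtx-concat ρ Γs))

  vars-renameCtx : ∀ ρ Γ → vars (renameCtx ρ Γ) ≡ map ρ (vars Γ)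
  vars-renameCtx ρ []      = refl
  vars-renameCtx ρ (p ∷ Γ) = cong (ρ (proj₁ p) ∷_) (vars-renameCtx ρ Γ)

  types-renameCtx : ∀ ρ Γ → types (renameCtx ρ Γ) ≡ types Γ
  types-renameCtx ρ []      = refl
  types-renameCtx ρ (p ∷ Γ) = cong (proj₂ p ∷_) (types-renameCtx ρ Γ)

  renameCtx-id-on : ∀ ρ Γ → (∀ {v} → v ∈ vars Γ → ρ v ≡ v) → renameCtx ρ Γ ≡ Γ
  renameCtx-id-on ρ []            fixed = refl
  renameCtx-id-on ρ ((v , A) ∷ Γ) fixed =
    cong₂ _∷_ (cong (_, A) (fixed (here refl))) (renameCtx-id-on ρ Γ (fixed ∘ there))

  renameCtx-involutive : ∀ ρ → (∀ v → ρ (ρ v) ≡ v) → ∀ Γ → renameCtx ρ (renameCtx ρ Γ) ≡ Γ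
  renameCtx-involutive ρ inv []            = refl
  renameCtx-involutive ρ inv ((v , A) ∷ Γ) = cong₂ _∷_ (cong (_, A) (inv v)) (renameCtx-involutive ρ inv Γ)

  module _ (ρ : Var → Var) (ρ-injective : Injective _≡_ _≡_ ρ) where

    Distinct-renameCtx : ∀ {Γ} → Distinct Γ → Distinct (renameCtx ρ Γ)
    Distinct-renameCtx {Γ} u = subst Unique (sym (vars-renameCtx ρ Γ)) (Unique.map⁺ ρ-injective u)

    rename-contracted : ∀ Δ Δ′ t →
      bindT (vars (renameCtx ρ Δ′) ↦ map var (vars (renameCtx ρ Δ))) (bindT (var ∘ ρ) t)
        ≡ bindT (var ∘ ρ) (bindT (vars Δ′ ↦ map var (vars Δ)) t)
    rename-contracted Δ Δ′ t = begin
      bindT (vars (renameCtx ρ Δ′) ↦ map var (vars (renameCtx ρ Δ))) (bindT (var ∘ ρ) t)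
        ≡⟨ cong₂ (λ xs ys → bindT (xs ↦ map var ys) (bindT (var ∘ ρ) t)) (vars-renameCtx ρ Δ′) (vars-renameCtx ρ Δ) ⟩
      bindT (map ρ (vars Δ′) ↦ map var (map ρ (vars Δ))) (bindT (var ∘ ρ) t)
        ≡⟨ bindT-∘ _ (var ∘ ρ) t ⟩
      bindT (λ v → (map ρ (vars Δ′) ↦ map var (map ρ (vars Δ))) (ρ v)) t
        ≡⟨ bindT-cong t (↦-rename ρ ρ-injective (vars Δ′) (vars Δ)) ⟩
      bindT (bindA (var ∘ ρ) ∘ (vars Δ′ ↦ map var (vars Δ))) t
        ≡⟨ bindT-∘ (var ∘ ρ) _ t ⟨
      bindT (var ∘ ρ) (bindT (vars Δ′ ↦ map var (vars Δ)) t) ∎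
      where open ≡-Reasoning

    mutual
      rename : ∀ {Γ t B} → Γ ⊢ t ∶ B → renameCtx ρ Γ ⊢ bindT (var ∘ ρ) t ∶ B
      rename (variable′ x A) = variable′ (ρ x) A
      rename (function f {Γs} args u) =
        castCtx (sym (renameCtx-concat ρ Γs))
          (function f (renameArgs args) (subst Distinct (renameCtx-concat ρ Γs) (Distinct-renameCtx u)))
      rename (substitution () _ _ _)
      rename unit = unit
      rename (tensor {Γ = Γ} {Δ} {s} {t} d e u) =
        castTerm (sym (bindT-++ (var ∘ ρ) s t)) (castCtx (sym (renameCtx-++ ρ Γ Δ))
          (tensor (rename d) (rename e) (subst Distinct (renameCtx-++ ρ Γ Δ) (Distinct-renameCtx u))))
      rename (weaken {Γ₁ = Γ₁} {Γ₂} {Γ₃} w d u) =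
        castCtx (sym (renameCtx-++³ ρ Γ₁ Γ₂ Γ₃))
          (weaken {Γ₁ = renameCtx ρ Γ₁} {renameCtx ρ Γ₂} {renameCtx ρ Γ₃} w (castCtx (renameCtx-++ ρ Γ₁ Γ₃) (rename d))
            (subst Distinct (renameCtx-++³ ρ Γ₁ Γ₂ Γ₃) (Distinct-renameCtx u)))
      rename (exch w d Γ↭Γ′) = exch w (rename d) (↭.map⁺ _ Γ↭Γ′)
      rename (contract {Γ₁ = Γ₁} {Δ} {Δ′} {Γ₂} {t} w ty d) =
        castTerm contracted (castCtx (sym (renameCtx-++³ ρ Γ₁ Δ Γ₂))
          (contract {Γ₁ = renameCtx ρ Γ₁} {renameCtx ρ Δ} {renameCtx ρ Δ′} {renameCtx ρ Γ₂} w ty′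
            (castCtx (trans (renameCtx-++ ρ Γ₁ _) (cong (renameCtx ρ Γ₁ ++_) (renameCtx-++³ ρ Δ Δ′ Γ₂))) (rename d))))
        where
        ty′ : types (renameCtx ρ Δ) ≡ types (renameCtx ρ Δ′)
        ty′ = trans (types-renameCtx ρ Δ) (trans ty (sym (types-renameCtx ρ Δ′)))
        contracted : bindT (var ∘ ρ) t [ map var (vars (renameCtx ρ Δ)) / vars (renameCtx ρ Δ′) ]
                   ≡ bindT (var ∘ ρ) (t [ map var (vars Δ) / vars Δ′ ])
        contracted = trans ([/]≡bindT _ _ (vars (renameCtx ρ Δ′)))
                       (trans (rename-contracted Δ Δ′ t) (cong (bindT (var ∘ ρ)) (sym ([/]≡bindT t _ (vars Δ′)))))

      renameArgs : ∀ {Γs ts Bs} → Args false Γs ts Bs → Args false (map (renameCtx ρ) Γs) (bindTs (var ∘ ρ) ts) Bs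
      renameArgs []         = []
      renameArgs (d ∷ args) = rename d ∷ renameArgs args

  Distinct-contract-apart : ∀ Γ₁ Δ Δ′ Γ₂ → Distinct (Γ₁ ++ Δ ++ Δ′ ++ Γ₂) → Disjoint (vars Δ′) (vars (Γ₁ ++ Δ ++ Γ₂))
  Distinct-contract-apart Γ₁ Δ Δ′ Γ₂ u =
    subst (Disjoint (vars Δ′) ∘ vars) (++-assoc Γ₁ Δ Γ₂)
      (Distinct-++⇒Disjoint Δ′ (Distinct-↭ (↭.shifts (Γ₁ ++ Δ) Δ′) (subst Distinct (sym (++-assoc Γ₁ Δ (Δ′ ++ Γ₂))) u)))

  Distinct⇒sort-unique : ∀ {Γ v A B} → Distinct Γ → (v , A) ∈ Γ → (v , B) ∈ Γ → A ≡ B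
  Distinct⇒sort-unique u (here refl)   (here refl)   = refl
  Distinct⇒sort-unique u (here refl)   (there v,B∈) = ⊥-elim (Unique[x∷xs]⇒x∉xs u (∈-map⁺ proj₁ v,B∈))
  Distinct⇒sort-unique u (there v,A∈) (here refl)   = ⊥-elim (Unique[x∷xs]⇒x∉xs u (∈-map⁺ proj₁ v,A∈))
  Distinct⇒sort-unique u (there v,A∈) (there v,B∈) = Distinct⇒sort-unique (Unique-tail u) v,A∈ v,B∈

  types-split : ∀ Δ B₁ B₂ → types Δ ≡ B₁ ++ B₂ →
    Σ[ Δ₁ ∈ Ctx ] Σ[ Δ₂ ∈ Ctx ] Δ ≡ Δ₁ ++ Δ₂ × types Δ₁ ≡ B₁ × types Δ₂ ≡ B₂
  types-split Δ             []       B₂ eq = [] , Δ , refl , refl , eq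
  types-split ((x , A) ∷ Δ) (B ∷ B₁) B₂ eq with ∷-injective eq
  ... | refl , eq′ with types-split Δ B₁ B₂ eq′
  ...   | Δ₁ , Δ₂ , refl , eq₁ , eq₂ = (x , A) ∷ Δ₁ , Δ₂ , refl , cong (A ∷_) eq₁ , eq₂

  types-∷ : ∀ {A Bs} Δ → types Δ ≡ A ∷ Bs → Σ[ x ∈ Var ] Σ[ Δ′ ∈ Ctx ] Δ ≡ (x , A) ∷ Δ′ × types Δ′ ≡ Bs
  types-∷ ((x , A) ∷ Δ′) eq with ∷-injective eq
  ... | refl , eq′ = x , Δ′ , refl , eq′

  types-singleton : ∀ {A} Δ → types Δ ≡ A ∷ [] → Σ[ x ∈ Var ] Δ ≡ (x , A) ∷ []
  types-singleton ((x , A) ∷ []) refl = x , refl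

  Distinct-at : ∀ Γ {x A} Δ → Distinct (Γ ++ (x , A) ∷ Δ) → x ∉ vars Γ × x ∉ vars Δ
  Distinct-at Γ Δ u = (λ x∈Γ → Distinct-++⇒Disjoint Γ u (x∈Γ , here refl)) , Unique[x∷xs]⇒x∉xs (Distinct-++⁻ʳ Γ u)

  types-empty : ∀ Δ → types Δ ≡ [] → Δ ≡ []
  types-empty [] _ = refl

  args-length : ∀ {b Γs ts Bs} → Args b Γs ts Bs → length ts ≡ length Bs
  args-length []         = refl
  args-length (d ∷ args) = cong suc (args-length args)

  vars-zip : ∀ (ys : List Var) (Bs : List Sort) → length ys ≡ length Bs → vars (zip ys Bs) ≡ ys
  vars-zip []       []       _   = refl
  vars-zip (y ∷ ys) (B ∷ Bs) len = cong (y ∷_) (vars-zip ys Bs (suc-injective len))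

  types-zip : ∀ (ys : List Var) (Bs : List Sort) → length ys ≡ length Bs → types (zip ys Bs) ≡ Bs
  types-zip []       []       _   = refl
  types-zip (y ∷ ys) (B ∷ Bs) len = cong (B ∷_) (types-zip ys Bs (suc-injective len))

  AtSort : Var → Sort → Ctx → Set
  AtSort x B Γ = ∀ {A} → (x , A) ∈ Γ → A ≡ B

  -- Expansion of a variable x into f(y₁,…,yₙ)

  module Expansion (f : Fun) where

    argCtx : List Var → Ctx
    argCtx ys = zip ys (dom f)

    vars-argCtx : ∀ ys → length ys ≡ length (dom f) → vars (argCtx ys) ≡ ys
    vars-argCtx ys = vars-zip ys (dom f)

    appVars : List Var → ATerm
    appVars ys = app f (map (λ y → var y ∷ []) ys)

    bindTs-singletons : ∀ φ ys → bindTs φ (map (λ y → var y ∷ []) ys) ≡ map (λ y → φ y ∷ []) ys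
    bindTs-singletons φ []       = refl
    bindTs-singletons φ (y ∷ ys) = cong ((φ y ∷ []) ∷_) (bindTs-singletons φ ys)

    bindA-appVars : ∀ φ ys → bindA φ (appVars ys) ≡ app f (map (λ y → φ y ∷ []) ys)
    bindA-appVars φ ys = cong (app f) (bindTs-singletons φ ys)

    appVars-rename : ∀ φ ys zs → map φ ys ≡ map var zs → bindA φ (appVars ys) ≡ appVars zs
    appVars-rename φ ys zs φys≡zs = trans (bindA-appVars φ ys) (cong (app f) (begin
      map (λ y → φ y ∷ []) ys        ≡⟨ map-∘ ys ⟩
      map (_∷ []) (map φ ys)         ≡⟨ cong (map (_∷ [])) φys≡zs ⟩
      map (_∷ []) (map var zs)       ≡⟨ map-∘ zs ⟨
      map (λ z → var z ∷ []) zs      ∎))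
      where open ≡-Reasoning

    appVars-fixed : ∀ φ ys → (∀ {y} → y ∈ ys → φ y ≡ var y) → bindA φ (appVars ys) ≡ appVars ys
    appVars-fixed φ ys φ≡var = appVars-rename φ ys ys (map-cong-local (All.tabulate φ≡var))

    variableArgs : ∀ ys Bs → length ys ≡ length Bs → Args false (map (_∷ []) (zip ys Bs)) (map (λ y → var y ∷ []) ys) Bs
    variableArgs []       []       _   = []
    variableArgs (y ∷ ys) (B ∷ Bs) len = variable′ y B ∷ variableArgs ys Bs (suc-injective len)

    variableArgs-contractions : ∀ ys Bs len → argsContractions (variableArgs ys Bs len) ≡ 0
    variableArgs-contractions []       []       _   = refl
    variableArgs-contractions (y ∷ ys) (B ∷ Bs) len = variableArgs-contractions ys Bs (suc-injective len)

    ⊢appVars : ∀ ys → length ys ≡ length (dom f) → Unique ys → argCtx ys ⊢ appVars ys ∷ [] ∶ cod f ∷ []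
    ⊢appVars ys len u = castCtx (concat-map-[ argCtx ys ])
      (function f (variableArgs ys (dom f) len) (subst Unique (sym vars≡ys) u))
      where
      vars≡ys : vars (concat (map (_∷ []) (argCtx ys))) ≡ ys
      vars≡ys = trans (cong vars (concat-map-[ argCtx ys ])) (vars-zip ys (dom f) len)

    ⊢appVars-contractions : ∀ ys len u → contractions (⊢appVars ys len u) ≡ 0
    ⊢appVars-contractions ys len u =
      trans (contractions-castCtx (concat-map-[ argCtx ys ]) _) (variableArgs-contractions ys (dom f) len)

    expansion : Var → List Var → Var → ATerm
    expansion x ys = x ∷ [] ↦ appVars ys ∷ []

    expandEntry : Var → List Var → Var × Sort → Ctx
    expandEntry x ys (v , A) with v ≟ x
    ... | yes _ = argCtx ys
    ... | no _  = (v , A) ∷ []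

    expandCtx : Var → List Var → Ctx → Ctx
    expandCtx x ys = concatMap (expandEntry x ys)

    module _ (x : Var) (ys : List Var) where

      expandEntry-≢ : ∀ {v} A → v ≢ x → expandEntry x ys (v , A) ≡ (v , A) ∷ []
      expandEntry-≢ {v} A v≢x with v ≟ x
      ... | yes v≡x = ⊥-elim (v≢x v≡x)
      ... | no _    = refl

      expandEntry-≡ : ∀ A → expandEntry x ys (x , A) ≡ argCtx ys
      expandEntry-≡ A with x ≟ x
      ... | yes _   = refl
      ... | no x≢x = ⊥-elim (x≢x refl)

      expandCtx-++ : ∀ Γ Δ → expandCtx x ys (Γ ++ Δ) ≡ expandCtx x ys Γ ++ expandCtx x ys Δ
      expandCtx-++ = concatMap-++ (expandEntry x ys)

      expandCtx-++³ : ∀ Γ Δ Θ → expandCtx x ys (Γ ++ Δ ++ Θ) ≡ expandCtx x ys Γ ++ expandCtx x ys Δ ++ expandCtx x ys Θ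
      expandCtx-++³ Γ Δ Θ = trans (expandCtx-++ Γ _) (cong (expandCtx x ys Γ ++_) (expandCtx-++ Δ Θ))

      expandCtx-∉ : ∀ Γ → x ∉ vars Γ → expandCtx x ys Γ ≡ Γ
      expandCtx-∉ []            _   = refl
      expandCtx-∉ ((v , A) ∷ Γ) x∉ =
        cong₂ _++_ (expandEntry-≢ A (λ v≡x → x∉ (here (sym v≡x)))) (expandCtx-∉ Γ (x∉ ∘ there))

      expandCtx-at : ∀ Γ A Δ → x ∉ vars Γ → x ∉ vars Δ → expandCtx x ys (Γ ++ (x , A) ∷ Δ) ≡ Γ ++ argCtx ys ++ Δ
      expandCtx-at Γ A Δ x∉Γ x∉Δ =
        trans (expandCtx-++ Γ ((x , A) ∷ Δ))
          (cong₂ _++_ (expandCtx-∉ Γ x∉Γ) (cong₂ _++_ (expandEntry-≡ A) (expandCtx-∉ Δ x∉Δ)))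

      expandCtx-concat : ∀ Γs → expandCtx x ys (concat Γs) ≡ concat (map (expandCtx x ys) Γs)
      expandCtx-concat []       = refl
      expandCtx-concat (Γ ∷ Γs) = trans (expandCtx-++ Γ (concat Γs)) (cong (expandCtx x ys Γ ++_) (expandCtx-concat Γs))

      expandCtx-↭ : ∀ {Γ Δ} → Γ ↭ Δ → expandCtx x ys Γ ↭ expandCtx x ys Δ
      expandCtx-↭ Perm.refl         = Perm.refl
      expandCtx-↭ (Perm.prep p q)   = ↭.++⁺ˡ (expandEntry x ys p) (expandCtx-↭ q)
      expandCtx-↭ (Perm.swap p q r) =
        Perm.trans (↭.shifts (expandEntry x ys p) (expandEntry x ys q))
          (↭.++⁺ˡ (expandEntry x ys q) (↭.++⁺ˡ (expandEntry x ys p) (expandCtx-↭ r)))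
      expandCtx-↭ (Perm.trans p q)  = Perm.trans (expandCtx-↭ p) (expandCtx-↭ q)

      module _ (len : length ys ≡ length (dom f)) where

        ∈vars-expandEntry : ∀ p {w} → w ∈ vars (expandEntry x ys p) → w ≡ proj₁ p ⊎ w ∈ ys
        ∈vars-expandEntry (v , A) w∈ with v ≟ x
        ∈vars-expandEntry (v , A) w∈          | yes _ = inj₂ (subst (_ ∈_) (vars-argCtx ys len) w∈)
        ∈vars-expandEntry (v , A) (here refl) | no _  = inj₁ refl

        ∈vars-expandCtx : ∀ Γ {w} → w ∈ vars (expandCtx x ys Γ) → w ∈ vars Γ ⊎ w ∈ ys
        ∈vars-expandCtx (p ∷ Γ) w∈ with ∈vars-++⁻ (expandEntry x ys p) (expandCtx x ys Γ) w∈
        ... | inj₁ w∈p with ∈vars-expandEntry p w∈p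
        ...   | inj₁ refl = inj₁ (here refl)
        ...   | inj₂ w∈ys = inj₂ w∈ys
        ∈vars-expandCtx (p ∷ Γ) w∈ | inj₂ w∈Γ with ∈vars-expandCtx Γ w∈Γ
        ...   | inj₁ w∈Γ′ = inj₁ (there w∈Γ′)
        ...   | inj₂ w∈ys = inj₂ w∈ys

        ∈vars-expandCtx⁺ : ∀ Γ {v} → v ∈ vars Γ → v ≢ x → v ∈ vars (expandCtx x ys Γ)
        ∈vars-expandCtx⁺ ((w , A) ∷ Γ) (here refl) v≢x =
          ∈vars-++⁺ˡ (expandEntry x ys (w , A)) _ (subst (λ Θ → w ∈ vars Θ) (sym (expandEntry-≢ A v≢x)) (here refl))
        ∈vars-expandCtx⁺ (p ∷ Γ) (there v∈) v≢x = ∈vars-++⁺ʳ (expandEntry x ys p) _ (∈vars-expandCtx⁺ Γ v∈ v≢x)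

        ∈vars-expandCtx-args : ∀ Γ {y} → x ∈ vars Γ → y ∈ ys → y ∈ vars (expandCtx x ys Γ)
        ∈vars-expandCtx-args ((x , A) ∷ Γ) (here refl) y∈ =
          ∈vars-++⁺ˡ (expandEntry x ys (x , A)) _ (subst (λ Θ → _ ∈ vars Θ) (sym (expandEntry-≡ A)) (subst (_ ∈_) (sym (vars-argCtx ys len)) y∈))
        ∈vars-expandCtx-args (p ∷ Γ) (there x∈) y∈ = ∈vars-++⁺ʳ (expandEntry x ys p) _ (∈vars-expandCtx-args Γ x∈ y∈)

        Distinct-expandCtx : ∀ Γ → Distinct Γ → Unique ys → Disjoint ys (vars Γ) → Distinct (expandCtx x ys Γ)
        Distinct-expandCtx []            _ _  _      = []
        Distinct-expandCtx ((v , A) ∷ Γ) u uy ys#Γ with v ≟ x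
        ... | yes refl =
          Distinct-++⁺ (subst Unique (sym (vars-argCtx ys len)) uy) (subst Distinct (sym Γ-fixed) (Unique-tail u))
            (λ (w∈ys , w∈Γ) → ys#Γ (subst (_ ∈_) (vars-argCtx ys len) w∈ys , there (subst (λ Θ → _ ∈ vars Θ) Γ-fixed w∈Γ)))
          where
          Γ-fixed : expandCtx x ys Γ ≡ Γ
          Γ-fixed = expandCtx-∉ Γ (Unique[x∷xs]⇒x∉xs u)
        ... | no _ =
          Distinct-++⁺ {Γ = (v , A) ∷ []} (Unique-∷ (λ ()) [])
            (Distinct-expandCtx Γ (Unique-tail u) uy (λ (w∈ys , w∈Γ) → ys#Γ (w∈ys , there w∈Γ)))
            (λ { (here refl , v∈) → [ Unique[x∷xs]⇒x∉xs u , (λ v∈ys → ys#Γ (v∈ys , here refl)) ] (∈vars-expandCtx Γ v∈) })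

      expansion-≡ : expansion x ys x ≡ appVars ys
      expansion-≡ = ↦-here x [] (appVars ys) []

      expansion-≢ : ∀ {v} → v ≢ x → expansion x ys v ≡ var v
      expansion-≢ v≢x = ↦-there x [] (appVars ys) [] v≢x

      expansion-commutes : ∀ xs zs → length xs ≡ length zs → x ∉ xs → x ∉ zs → Disjoint ys xs → ∀ v →
        bindA (xs ↦ map var zs) (expansion x ys v) ≡ bindA (expansion x ys) ((xs ↦ map var zs) v)
      expansion-commutes xs zs len x∉xs x∉zs ys#xs v with v ≟ x
      ... | yes refl = begin
        bindA (xs ↦ map var zs) (appVars ys)   ≡⟨ appVars-fixed _ ys (λ y∈ → ↦-∉ xs _ (λ y∈xs → ys#xs (y∈ , y∈xs))) ⟩
        appVars ys                             ≡⟨ expansion-≡ ⟨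
        expansion x ys x                       ≡⟨ cong (bindA (expansion x ys)) (↦-∉ xs _ x∉xs) ⟨
        bindA (expansion x ys) ((xs ↦ map var zs) x) ∎
        where open ≡-Reasoning
      ... | no v≢x with ↦-renaming xs zs v len
      ...   | w , w≡v⊎w∈zs , eq = begin
        (xs ↦ map var zs) v                          ≡⟨ eq ⟩
        var w                                        ≡⟨ expansion-≢ w≢x ⟨
        bindA (expansion x ys) (var w)               ≡⟨ cong (bindA (expansion x ys)) eq ⟨
        bindA (expansion x ys) ((xs ↦ map var zs) v) ∎
        where
        open ≡-Reasoning
        w≢x : w ≢ x
        w≢x refl = [ v≢x ∘ sym , x∉zs ] w≡v⊎w∈zs

    module _ (x x′ : Var) (ys ys′ a b a′ b′ : List Var)
             (|a′|≡|a| : length a′ ≡ length a) (|b′|≡|b| : length b′ ≡ length b) (|ys′|≡|ys| : length ys′ ≡ length ys)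
             (ys′-unique : Unique ys′) (x∉a : x ∉ a) (x∉b : x ∉ b) (x∉D′ : x ∉ a′ ++ x′ ∷ b′) (x′∉a′ : x′ ∉ a′)
             (ys#D′ : Disjoint ys (a′ ++ x′ ∷ b′)) (ys′#ys : Disjoint ys′ ys) (a′#ys′ : Disjoint a′ ys′) where

      private
        ζ : Var → ATerm
        ζ = a′ ++ b′ ↦ map var a ++ map var b

        len-a : length a′ ≡ length (map var a)
        len-a = trans |a′|≡|a| (sym (length-map var a))

        map-var³ : ∀ xs zs ws → map var (xs ++ zs ++ ws) ≡ map var xs ++ map var zs ++ map var ws
        map-var³ xs zs ws = trans (map-++ var xs _) (cong (map var xs ++_) (map-++ var zs ws))

        ζ-avoids-x : ∀ v → v ≢ x → bindA (expansion x ys) (ζ v) ≡ ζ v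
        ζ-avoids-x v v≢x with ↦-renaming (a′ ++ b′) (a ++ b) v (trans (length-++ a′) (trans (cong₂ _+_ |a′|≡|a| |b′|≡|b|) (sym (length-++ a))))
        ... | w , w≡v⊎w∈ab , eq =
          trans (cong (bindA (expansion x ys)) ζ≡) (trans (expansion-≢ x ys w≢x) (sym ζ≡))
          where
          ζ≡ : ζ v ≡ var w
          ζ≡ = trans (cong (λ s → (a′ ++ b′ ↦ s) v) (sym (map-++ var a b))) eq
          w≢x : w ≢ x
          w≢x refl = [ v≢x ∘ sym , [ x∉a , x∉b ] ∘ ∈-++⁻ a ] w≡v⊎w∈ab

      expansion-contracted : ∀ v → (v ≢ x → v ∉ ys′) →
        bindA (a′ ++ ys′ ++ b′ ↦ map var (a ++ ys ++ b)) (bindA (expansion x′ ys′) (expansion x ys v))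
          ≡ bindA (expansion x ys) ((a′ ++ x′ ∷ b′ ↦ map var (a ++ x ∷ b)) v)
      expansion-contracted v v∉ys′ with v ≟ x
      ... | yes refl = begin
        bindA zE (bindA (expansion x′ ys′) (appVars ys))
          ≡⟨ cong (bindA zE) (appVars-fixed _ ys (λ y∈ → expansion-≢ x′ ys′ (λ { refl → ys#D′ (y∈ , ∈-++⁺ʳ a′ (here refl)) }))) ⟩
        bindA zE (appVars ys)                             ≡⟨ appVars-fixed zE ys (λ y∈ → ↦-∉ (a′ ++ ys′ ++ b′) _ (ys∉E y∈)) ⟩
        appVars ys                                        ≡⟨ expansion-≡ x ys ⟨
        expansion x ys x                                  ≡⟨ cong (bindA (expansion x ys)) (↦-∉ (a′ ++ x′ ∷ b′) _ x∉D′) ⟨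
        bindA (expansion x ys) (zD x)                     ∎
        where
        open ≡-Reasoning
        zE = a′ ++ ys′ ++ b′ ↦ map var (a ++ ys ++ b)
        zD = a′ ++ x′ ∷ b′ ↦ map var (a ++ x ∷ b)
        ys∉E : ∀ {y} → y ∈ ys → y ∉ a′ ++ ys′ ++ b′
        ys∉E y∈ y∈E with ∈-++⁻ a′ y∈E
        ... | inj₁ y∈a′ = ys#D′ (y∈ , ∈-++⁺ˡ y∈a′)
        ... | inj₂ y∈′ with ∈-++⁻ ys′ y∈′
        ...   | inj₁ y∈ys′ = ys′#ys (y∈ys′ , y∈)
        ...   | inj₂ y∈b′  = ys#D′ (y∈ , ∈-++⁺ʳ a′ (there y∈b′))
      ... | no v≢x with v ≟ x′
      ...   | yes refl = begin
        bindA zE (appVars ys′)      ≡⟨ appVars-rename zE ys′ ys (↦-block a′ ys′ b′ a ys b a′#ys′ ys′-unique |a′|≡|a| |ys′|≡|ys|) ⟩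
        appVars ys                  ≡⟨ expansion-≡ x ys ⟨
        bindA (expansion x ys) (var x) ≡⟨ cong (bindA (expansion x ys)) zD-x′ ⟨
        bindA (expansion x ys) (zD x′) ∎
        where
        open ≡-Reasoning
        zE = a′ ++ ys′ ++ b′ ↦ map var (a ++ ys ++ b)
        zD = a′ ++ x′ ∷ b′ ↦ map var (a ++ x ∷ b)
        zD-x′ : zD x′ ≡ var x
        zD-x′ = ∷-injectiveˡ (↦-block a′ (x′ ∷ []) b′ a (x ∷ []) b (λ { (x′∈a′ , here refl) → x′∉a′ x′∈a′ }) (Unique-∷ (λ ()) []) |a′|≡|a| refl)
      ...   | no v≢x′ = begin
        (a′ ++ ys′ ++ b′ ↦ map var (a ++ ys ++ b)) v          ≡⟨ cong (λ s → (a′ ++ ys′ ++ b′ ↦ s) v) (map-var³ a ys b) ⟩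
        (a′ ++ ys′ ++ b′ ↦ map var a ++ map var ys ++ map var b) v
          ≡⟨ ↦-replace-middle a′ ys′ [] b′ (map var a) (map var ys) [] (map var b) len-a
               (trans |ys′|≡|ys| (sym (length-map var ys))) refl (v∉ys′ v≢x) (λ ()) ⟩
        ζ v                                                  ≡⟨ ζ-avoids-x v v≢x ⟨
        bindA (expansion x ys) (ζ v)
          ≡⟨ cong (bindA (expansion x ys)) (↦-replace-middle a′ (x′ ∷ []) [] b′ (map var a) (var x ∷ []) [] (map var b)
               len-a refl refl (λ { (here refl) → v≢x′ refl }) (λ ())) ⟨
        bindA (expansion x ys) ((a′ ++ x′ ∷ b′ ↦ map var a ++ var x ∷ map var b) v)
          ≡⟨ cong (λ s → bindA (expansion x ys) ((a′ ++ x′ ∷ b′ ↦ s) v)) (map-var³ a (x ∷ []) b) ⟨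
        bindA (expansion x ys) ((a′ ++ x′ ∷ b′ ↦ map var (a ++ x ∷ b)) v) ∎
        where open ≡-Reasoning

      bindT-expansion-contracted : ∀ {P} t → ScopedT P t → (∀ {v} → v ∈ P → v ≢ x → v ∉ ys′) →
        bindT (a′ ++ ys′ ++ b′ ↦ map var (a ++ ys ++ b)) (bindT (expansion x′ ys′) (bindT (expansion x ys) t))
          ≡ bindT (expansion x ys) (bindT (a′ ++ x′ ∷ b′ ↦ map var (a ++ x ∷ b)) t)
      bindT-expansion-contracted t sc v∉ys′ = begin
        bindT zE (bindT (expansion x′ ys′) (bindT (expansion x ys) t))   ≡⟨ cong (bindT zE) (bindT-∘ _ _ t) ⟩
        bindT zE (bindT (bindA (expansion x′ ys′) ∘ expansion x ys) t)   ≡⟨ bindT-∘ _ _ t ⟩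
        bindT (bindA zE ∘ bindA (expansion x′ ys′) ∘ expansion x ys) t  ≡⟨ bindT-cong-on t sc (λ v∈ → expansion-contracted _ (v∉ys′ v∈)) ⟩
        bindT (bindA (expansion x ys) ∘ zD) t                            ≡⟨ bindT-∘ _ _ t ⟨
        bindT (expansion x ys) (bindT zD t)                              ∎
        where
        open ≡-Reasoning
        zE = a′ ++ ys′ ++ b′ ↦ map var (a ++ ys ++ b)
        zD = a′ ++ x′ ∷ b′ ↦ map var (a ++ x ∷ b)

    record FreshArgs (ys V : List Var) : Set where
      field
        length≡ : length ys ≡ length (dom f)
        unique  : Unique ys
        fresh   : Disjoint ys V

    open FreshArgs

    FreshArgs-⊆ : ∀ {ys V W} → (∀ {v} → v ∈ W → v ∈ V) → FreshArgs ys V → FreshArgs ys W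
    FreshArgs-⊆ W⊆V fa = record { length≡ = length≡ fa ; unique = unique fa ; fresh = λ (v∈ys , v∈W) → fresh fa (v∈ys , W⊆V v∈W) }

    freshArgs : ∀ V → FreshArgs (freshVars V (length (dom f))) V
    freshArgs V = record
      { length≡ = length-freshVars V (length (dom f)) ; unique = freshVars-unique V _ ; fresh = freshVars-fresh V _ }

    Distinct-expandCtx-fresh : ∀ {x ys Γ V} → FreshArgs ys (vars Γ ++ V) → Distinct Γ → Distinct (expandCtx x ys Γ)
    Distinct-expandCtx-fresh {x} {ys} {Γ} fa u =
      Distinct-expandCtx x ys (length≡ fa) Γ u (unique fa) (λ (v∈ys , v∈Γ) → fresh fa (v∈ys , ∈-++⁺ˡ v∈Γ))

    Expanded : Var → List Var → ∀ {Γ t C} → Γ ⊢ t ∶ C → Set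
    Expanded x ys {Γ} {t} {C} d =
      Σ[ d′ ∈ expandCtx x ys Γ ⊢ bindT (expansion x ys) t ∶ C ] contractions d′ ≡ contractions d

    recast : ∀ {Γ Γ′ t t′ C k} → Γ ≡ Γ′ → t ≡ t′ → (d : Γ ⊢ t ∶ C) → contractions d ≡ k →
      Σ[ d′ ∈ Γ′ ⊢ t′ ∶ C ] contractions d′ ≡ k
    recast refl refl d eq = d , eq

    expand-absent : ∀ {Γ t C} x ys (d : Γ ⊢ t ∶ C) → x ∉ vars Γ → Expanded x ys d
    expand-absent {Γ} {t} x ys d x∉Γ =
      recast (sym (expandCtx-∉ x ys Γ x∉Γ))
        (sym (bindT-id-on t (⊢-scoped d) (λ v∈Γ → expansion-≢ x ys (λ { refl → x∉Γ v∈Γ }))))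
        d refl

    expanded-twins-term≡ : ∀ Γ₁ Δa S Δb Δa′ x′ Δb′ Γ₂ x t ys ys′ →
      let premise = Γ₁ ++ (Δa ++ (x , S) ∷ Δb) ++ (Δa′ ++ (x′ , S) ∷ Δb′) ++ Γ₂ in
      Distinct premise → ScopedT (vars premise) t → types Δa′ ≡ types Δa → types Δb′ ≡ types Δb →
      FreshArgs ys (vars premise) → FreshArgs ys′ (vars (expandCtx x ys premise)) →
      bindT (expansion x′ ys′) (bindT (expansion x ys) t) [ map var (vars (Δa ++ argCtx ys ++ Δb)) / vars (Δa′ ++ argCtx ys′ ++ Δb′) ]
        ≡ bindT (expansion x ys) (t [ map var (vars (Δa ++ (x , S) ∷ Δb)) / vars (Δa′ ++ (x′ , S) ∷ Δb′) ])
    expanded-twins-term≡ Γ₁ Δa S Δb Δa′ x′ Δb′ Γ₂ x t ys ys′ u sc tyA tyB fa fa′ = begin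
      bindT φ′ (bindT φ t) [ map var (vars (Δa ++ argCtx ys ++ Δb)) / vars (Δa′ ++ argCtx ys′ ++ Δb′) ]
        ≡⟨ [/]≡bindT _ _ (vars (Δa′ ++ argCtx ys′ ++ Δb′)) ⟩
      bindT (vars (Δa′ ++ argCtx ys′ ++ Δb′) ↦ map var (vars (Δa ++ argCtx ys ++ Δb))) (bindT φ′ (bindT φ t))
        ≡⟨ cong₂ (λ xs zs → bindT (xs ↦ map var zs) (bindT φ′ (bindT φ t))) (vars-block Δa′ Δb′ fa′) (vars-block Δa Δb fa) ⟩
      bindT (a′ ++ ys′ ++ b′ ↦ map var (a ++ ys ++ b)) (bindT φ′ (bindT φ t))
        ≡⟨ bindT-expansion-contracted x x′ ys ys′ a b a′ b′ (length-vars-≡ tyA) (length-vars-≡ tyB)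
             (trans (length≡ fa′) (sym (length≡ fa))) (unique fa′) x∉a x∉b x∉D′ x′∉a′ ys#D′ ys′#ys a′#ys′ t sc v∉ys′ ⟩
      bindT φ (bindT (a′ ++ x′ ∷ b′ ↦ map var (a ++ x ∷ b)) t)
        ≡⟨ cong₂ (λ xs zs → bindT φ (bindT (xs ↦ map var zs) t)) (vars-++ Δa′ _) (vars-++ Δa _) ⟨
      bindT φ (bindT (vars (Δa′ ++ (x′ , S) ∷ Δb′) ↦ map var (vars (Δa ++ (x , S) ∷ Δb))) t)
        ≡⟨ cong (bindT φ) ([/]≡bindT t _ (vars (Δa′ ++ (x′ , S) ∷ Δb′))) ⟨
      bindT φ (t [ map var (vars (Δa ++ (x , S) ∷ Δb)) / vars (Δa′ ++ (x′ , S) ∷ Δb′) ]) ∎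
      where
      open ≡-Reasoning
      φ = expansion x ys
      φ′ = expansion x′ ys′
      a = vars Δa ; b = vars Δb ; a′ = vars Δa′ ; b′ = vars Δb′
      Dx = Δa ++ (x , S) ∷ Δb
      D′ = Δa′ ++ (x′ , S) ∷ Δb′
      premise = Γ₁ ++ Dx ++ D′ ++ Γ₂
      vars-block : ∀ Θ Θ′ {zs V} → FreshArgs zs V → vars (Θ ++ argCtx zs ++ Θ′) ≡ vars Θ ++ zs ++ vars Θ′
      vars-block Θ Θ′ {zs} fz = trans (vars-++³ Θ (argCtx zs) Θ′) (cong (λ ws → vars Θ ++ ws ++ vars Θ′) (vars-argCtx zs (length≡ fz)))
      in-D′ : ∀ {v} → v ∈ a′ ++ x′ ∷ b′ → v ∈ vars premise
      in-D′ v∈ = ∈vars-++⁺ʳ Γ₁ _ (∈vars-++⁺ʳ Dx _ (∈vars-++⁺ˡ D′ Γ₂ (subst (_ ∈_) (sym (vars-++ Δa′ _)) v∈)))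
      x∈premise : x ∈ vars premise
      x∈premise = ∈vars-++⁺ʳ Γ₁ _ (∈vars-++⁺ˡ Dx _ (∈vars-++⁺ʳ Δa _ (here refl)))
      x-apart = Distinct-at (Γ₁ ++ Δa) (Δb ++ D′ ++ Γ₂)
        (subst Distinct (solve 6 (λ g a xx b d e → g ⊕ ((a ⊕ (xx ⊕ b)) ⊕ (d ⊕ e)) ⊜ (g ⊕ a) ⊕ (xx ⊕ (b ⊕ (d ⊕ e))))
                           refl Γ₁ Δa ((x , S) ∷ []) Δb D′ Γ₂) u)
      x∉a : x ∉ a
      x∉a = proj₁ x-apart ∘ ∈vars-++⁺ʳ Γ₁ Δa
      x∉b : x ∉ b
      x∉b = proj₂ x-apart ∘ ∈vars-++⁺ˡ Δb _
      x∉D′ : x ∉ a′ ++ x′ ∷ b′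
      x∉D′ = proj₂ x-apart ∘ ∈vars-++⁺ʳ Δb _ ∘ ∈vars-++⁺ˡ D′ Γ₂ ∘ subst (_ ∈_) (sym (vars-++ Δa′ _))
      x′∉a′ : x′ ∉ a′
      x′∉a′ = proj₁ (Distinct-at Δa′ Δb′ (Distinct-++⁻ˡ D′ (Distinct-++⁻ʳ Dx (Distinct-++⁻ʳ Γ₁ u))))
      ys#D′ : Disjoint ys (a′ ++ x′ ∷ b′)
      ys#D′ (y∈ys , y∈D′) = fresh fa (y∈ys , in-D′ y∈D′)
      ys′#ys : Disjoint ys′ ys
      ys′#ys (y∈ys′ , y∈ys) = fresh fa′ (y∈ys′ , ∈vars-expandCtx-args x ys (length≡ fa) premise x∈premise y∈ys)
      v∉ys′ : ∀ {v} → v ∈ vars premise → v ≢ x → v ∉ ys′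
      v∉ys′ v∈ v≢x v∈ys′ = fresh fa′ (v∈ys′ , ∈vars-expandCtx⁺ x ys (length≡ fa) premise v∈ v≢x)
      a′#ys′ : Disjoint a′ ys′
      a′#ys′ (v∈a′ , v∈ys′) = v∉ys′ (in-D′ (∈-++⁺ˡ v∈a′)) (λ { refl → x∉D′ (∈-++⁺ˡ v∈a′) }) v∈ys′

    mutual
      expand : ∀ {n Γ t C} (d : Γ ⊢ t ∶ C) → contractions d ≤ n →
        ∀ x ys → FreshArgs ys (allVars d) → AtSort x (cod f) Γ → Expanded x ys d
      expand (variable′ v A) _ x ys fa at with v ≟ x
      ... | no _ = variable′ v A , refl
      ... | yes refl with at (here refl)
      ...   | refl = recast (sym (++-identityʳ _)) refl (⊢appVars ys (length≡ fa) (unique fa))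
                       (⊢appVars-contractions ys (length≡ fa) (unique fa))
      expand (function g {Γs} args u) le x ys fa at
        with expandArgs args le x ys (FreshArgs-⊆ (∈-++⁺ʳ (vars (concat Γs))) fa) at
      ... | args′ , eq =
        recast (sym (expandCtx-concat x ys Γs)) refl
          (function g args′ (subst Distinct (expandCtx-concat x ys Γs) (Distinct-expandCtx-fresh fa u))) eq
      expand (substitution () _ _ _) _ _ _ _ _
      expand unit _ x ys fa at = unit , refl
      expand (tensor {Γ = Γ} {Δ} {s} {t} d e u) le x ys fa at
        with expand d (≤-trans (m≤m+n _ _) le) x ys (FreshArgs-⊆ (∈-++⁺ʳ (vars (Γ ++ Δ)) ∘ ∈-++⁺ˡ) fa) (at ∘ ∈-++⁺ˡ)
           | expand e (≤-trans (m≤n+m _ _) le) x ys (FreshArgs-⊆ (∈-++⁺ʳ (vars (Γ ++ Δ)) ∘ ∈-++⁺ʳ (allVars d)) fa) (at ∘ ∈-++⁺ʳ Γ)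
      ... | d′ , eq-d | e′ , eq-e =
        recast (sym (expandCtx-++ x ys Γ Δ)) (sym (bindT-++ _ s t))
          (tensor d′ e′ (subst Distinct (expandCtx-++ x ys Γ Δ) (Distinct-expandCtx-fresh fa u))) (cong₂ _+_ eq-d eq-e)
      expand (weaken {Γ₁ = Γ₁} {Γ₂} {Γ₃} w d u) le x ys fa at
        with expand d le x ys (FreshArgs-⊆ (∈-++⁺ʳ (vars (Γ₁ ++ Γ₂ ++ Γ₃))) fa) (at ∘ ∈-insert-middle Γ₁ Γ₂)
      ... | d′ , eq =
        recast (sym (expandCtx-++³ x ys Γ₁ Γ₂ Γ₃)) refl
          (weaken {Γ₁ = expandCtx x ys Γ₁} {expandCtx x ys Γ₂} {expandCtx x ys Γ₃} w (castCtx (expandCtx-++ x ys Γ₁ Γ₃) d′)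
             (subst Distinct (expandCtx-++³ x ys Γ₁ Γ₂ Γ₃) (Distinct-expandCtx-fresh fa u)))
          (trans (contractions-castCtx (expandCtx-++ x ys Γ₁ Γ₃) d′) eq)
      expand (exch {Γ′ = Γ′} w d Γ↭Γ′) le x ys fa at
        with expand d le x ys (FreshArgs-⊆ (∈-++⁺ʳ (vars Γ′)) fa) (at ∘ ↭.∈-resp-↭ Γ↭Γ′)
      ... | d′ , eq = exch w d′ (expandCtx-↭ x ys Γ↭Γ′) , eq
      expand (contract {Γ₁ = Γ₁} {Δ} {Δ′} {Γ₂} w ty d) (s≤s le) x ys fa at with x ∈? vars Δ | x ∈? vars Δ′
      ... | no x∉Δ | no x∉Δ′ = expand-outside Γ₁ Δ Δ′ Γ₂ w ty d le x ys fa at x∉Δ x∉Δ′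
      ... | no _ | yes x∈Δ′ =
        expand-absent x ys (contract {Γ₁ = Γ₁} {Δ} {Δ′} {Γ₂} w ty d) (λ x∈ → Distinct-contract-apart Γ₁ Δ Δ′ Γ₂ (⊢-distinct d) (x∈Δ′ , x∈))
      ... | yes x∈Δ | _ with ∈-map⁻ proj₁ x∈Δ
      ...   | (x , S) , x,S∈Δ , refl with ∈-∃++ x,S∈Δ
      ...     | Δa , Δb , refl with types-split Δ′ (types Δa) (S ∷ types Δb) (trans (sym ty) (types-++ Δa _))
      ...       | Δa′ , R , refl , tyA , tyR with types-∷ R tyR
      ...         | x′ , Δb′ , refl , tyB = expand-inside Γ₁ Δa S Δb Δa′ x′ Δb′ Γ₂ x w ty d le tyA tyB ys fa at

      expandArgs : ∀ {n Γs ts Bs} (args : Args false Γs ts Bs) → argsContractions args ≤ n →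
        ∀ x ys → FreshArgs ys (argsVars args) → AtSort x (cod f) (concat Γs) →
        Σ[ args′ ∈ Args false (map (expandCtx x ys) Γs) (bindTs (expansion x ys) ts) Bs ] argsContractions args′ ≡ argsContractions args
      expandArgs [] _ x ys fa at = [] , refl
      expandArgs (_∷_ {Γ} d args) le x ys fa at
        with expand d (≤-trans (m≤m+n _ _) le) x ys (FreshArgs-⊆ ∈-++⁺ˡ fa) (at ∘ ∈-++⁺ˡ)
           | expandArgs args (≤-trans (m≤n+m _ _) le) x ys (FreshArgs-⊆ (∈-++⁺ʳ (allVars d)) fa) (at ∘ ∈-++⁺ʳ Γ)
      ... | d′ , eq-d | args′ , eq-args = d′ ∷ args′ , cong₂ _+_ eq-d eq-args

      expand-outside : ∀ {n t C} Γ₁ Δ Δ′ Γ₂ w ty (d : Γ₁ ++ Δ ++ Δ′ ++ Γ₂ ⊢ t ∶ C) → contractions d ≤ n →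
        ∀ x ys → FreshArgs ys (allVars (contract {Γ₁ = Γ₁} {Δ} {Δ′} {Γ₂} w ty d)) → AtSort x (cod f) (Γ₁ ++ Δ ++ Γ₂) →
        x ∉ vars Δ → x ∉ vars Δ′ → Expanded x ys (contract {Γ₁ = Γ₁} {Δ} {Δ′} {Γ₂} w ty d)
      expand-outside {t = t} Γ₁ Δ Δ′ Γ₂ w ty d le x ys fa at x∉Δ x∉Δ′
        with expand d le x ys (FreshArgs-⊆ (∈-++⁺ʳ (vars (Γ₁ ++ Δ ++ Γ₂))) fa)
               (λ x∈ → at (∈-drop Γ₁ Δ Δ′ x∈ (x∉Δ′ ∘ ∈-map⁺ proj₁)))
      ... | d′ , eq =
        recast ctx≡ term≡
          (contract {Γ₁ = expandCtx x ys Γ₁} {Δ} {Δ′} {expandCtx x ys Γ₂} w ty (castCtx premise≡ d′))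
          (cong suc (trans (contractions-castCtx premise≡ d′) eq))
        where
        premise≡ : expandCtx x ys (Γ₁ ++ Δ ++ Δ′ ++ Γ₂) ≡ expandCtx x ys Γ₁ ++ Δ ++ Δ′ ++ expandCtx x ys Γ₂
        premise≡ = trans (expandCtx-++³ x ys Γ₁ Δ _)
                     (cong (λ Θ → expandCtx x ys Γ₁ ++ Θ) (cong₂ _++_ (expandCtx-∉ x ys Δ x∉Δ)
                       (trans (expandCtx-++ x ys Δ′ Γ₂) (cong (_++ expandCtx x ys Γ₂) (expandCtx-∉ x ys Δ′ x∉Δ′)))))
        ctx≡ : expandCtx x ys Γ₁ ++ Δ ++ expandCtx x ys Γ₂ ≡ expandCtx x ys (Γ₁ ++ Δ ++ Γ₂)
        ctx≡ = sym (trans (expandCtx-++³ x ys Γ₁ Δ Γ₂) (cong (λ Θ → expandCtx x ys Γ₁ ++ Θ ++ expandCtx x ys Γ₂) (expandCtx-∉ x ys Δ x∉Δ)))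
        ys#Δ′ : Disjoint ys (vars Δ′)
        ys#Δ′ (y∈ys , y∈Δ′) = fresh fa
          (y∈ys , ∈-++⁺ʳ (vars (Γ₁ ++ Δ ++ Γ₂)) (∈-++⁺ˡ (∈vars-++⁺ʳ Γ₁ _ (∈vars-++⁺ʳ Δ _ (∈vars-++⁺ˡ Δ′ Γ₂ y∈Δ′)))))
        term≡ : bindT (expansion x ys) t [ map var (vars Δ) / vars Δ′ ] ≡ bindT (expansion x ys) (t [ map var (vars Δ) / vars Δ′ ])
        term≡ = begin
          bindT (expansion x ys) t [ map var (vars Δ) / vars Δ′ ]
            ≡⟨ [/]≡bindT _ _ (vars Δ′) ⟩
          bindT (vars Δ′ ↦ map var (vars Δ)) (bindT (expansion x ys) t)
            ≡⟨ bindT-∘ _ _ t ⟩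
          bindT (bindA (vars Δ′ ↦ map var (vars Δ)) ∘ expansion x ys) t
            ≡⟨ bindT-cong t (expansion-commutes x ys (vars Δ′) (vars Δ) (length-vars-≡ (sym ty)) x∉Δ′ x∉Δ ys#Δ′) ⟩
          bindT (bindA (expansion x ys) ∘ (vars Δ′ ↦ map var (vars Δ))) t
            ≡⟨ bindT-∘ _ _ t ⟨
          bindT (expansion x ys) (bindT (vars Δ′ ↦ map var (vars Δ)) t)
            ≡⟨ cong (bindT (expansion x ys)) ([/]≡bindT t _ (vars Δ′)) ⟨
          bindT (expansion x ys) (t [ map var (vars Δ) / vars Δ′ ]) ∎
          where open ≡-Reasoning

      expand-inside : ∀ {n t C} Γ₁ Δa S Δb Δa′ x′ Δb′ Γ₂ x w ty
        (d : Γ₁ ++ (Δa ++ (x , S) ∷ Δb) ++ (Δa′ ++ (x′ , S) ∷ Δb′) ++ Γ₂ ⊢ t ∶ C) → contractions d ≤ n →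
        types Δa′ ≡ types Δa → types Δb′ ≡ types Δb → ∀ ys →
        FreshArgs ys (allVars (contract {Γ₁ = Γ₁} {Δa ++ (x , S) ∷ Δb} {Δa′ ++ (x′ , S) ∷ Δb′} {Γ₂} w ty d)) →
        AtSort x (cod f) (Γ₁ ++ (Δa ++ (x , S) ∷ Δb) ++ Γ₂) →
        Expanded x ys (contract {Γ₁ = Γ₁} {Δa ++ (x , S) ∷ Δb} {Δa′ ++ (x′ , S) ∷ Δb′} {Γ₂} w ty d)
      expand-inside {t = t} Γ₁ Δa S Δb Δa′ x′ Δb′ Γ₂ x w ty d le tyA tyB ys fa at =
        recast conclusion≡ term≡ (proj₁ r₂) (trans (proj₂ r₂) (cong suc (trans (contractions-castCtx premise≡ d₁) eq₁)))
        where
        Dx = Δa ++ (x , S) ∷ Δb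
        D′ = Δa′ ++ (x′ , S) ∷ Δb′
        K = argCtx ys
        shape : Γ₁ ++ Dx ++ D′ ++ Γ₂ ≡ (Γ₁ ++ Δa) ++ (x , S) ∷ Δb ++ D′ ++ Γ₂
        shape = solve 6 (λ g a xx b d e → g ⊕ ((a ⊕ (xx ⊕ b)) ⊕ (d ⊕ e)) ⊜ (g ⊕ a) ⊕ (xx ⊕ (b ⊕ (d ⊕ e)))) refl Γ₁ Δa ((x , S) ∷ []) Δb D′ Γ₂
        apart = Distinct-at (Γ₁ ++ Δa) (Δb ++ D′ ++ Γ₂) (subst Distinct shape (⊢-distinct d))
        S≡cod : S ≡ cod f
        S≡cod = at (∈-++⁺ʳ Γ₁ (∈-++⁺ˡ (∈-++⁺ʳ Δa (here refl))))
        at-premise : AtSort x (cod f) (Γ₁ ++ Dx ++ D′ ++ Γ₂)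
        at-premise x,A∈ = trans (Distinct⇒sort-unique (⊢-distinct d) x,A∈ (∈-++⁺ʳ Γ₁ (∈-++⁺ˡ (∈-++⁺ʳ Δa (here refl))))) S≡cod
        r₁ = expand d le x ys (FreshArgs-⊆ (∈-++⁺ʳ (vars (Γ₁ ++ Dx ++ Γ₂))) fa) at-premise
        d₁ = proj₁ r₁
        eq₁ = proj₂ r₁
        premise≡ : expandCtx x ys (Γ₁ ++ Dx ++ D′ ++ Γ₂) ≡ Γ₁ ++ (Δa ++ K ++ Δb) ++ D′ ++ Γ₂
        premise≡ = trans (cong (expandCtx x ys) shape) (trans (expandCtx-at x ys (Γ₁ ++ Δa) S _ (proj₁ apart) (proj₂ apart))
          (solve 6 (λ g a k b d e → (g ⊕ a) ⊕ (k ⊕ (b ⊕ (d ⊕ e))) ⊜ g ⊕ ((a ⊕ (k ⊕ b)) ⊕ (d ⊕ e))) refl Γ₁ Δa K Δb D′ Γ₂))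
        conclusion≡ : Γ₁ ++ (Δa ++ K ++ Δb) ++ Γ₂ ≡ expandCtx x ys (Γ₁ ++ Dx ++ Γ₂)
        conclusion≡ = sym (trans (cong (expandCtx x ys)
            (solve 5 (λ g a xx b e → g ⊕ ((a ⊕ (xx ⊕ b)) ⊕ e) ⊜ (g ⊕ a) ⊕ (xx ⊕ (b ⊕ e))) refl Γ₁ Δa ((x , S) ∷ []) Δb Γ₂))
          (trans (expandCtx-at x ys (Γ₁ ++ Δa) S (Δb ++ Γ₂) (proj₁ apart) (proj₂ apart ∘ ∈vars-middle Δb D′ Γ₂))
            (solve 5 (λ g a k b e → (g ⊕ a) ⊕ (k ⊕ (b ⊕ e)) ⊜ g ⊕ ((a ⊕ (k ⊕ b)) ⊕ e)) refl Γ₁ Δa K Δb Γ₂)))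
        d₁′ = castCtx premise≡ d₁
        ys′ = freshVars (allVars d₁′) (length (dom f))
        fa′ = freshArgs (allVars d₁′)
        blocks-types : types (Δa ++ K ++ Δb) ≡ types (Δa′ ++ argCtx ys′ ++ Δb′)
        blocks-types = trans (types-++³ Δa K Δb) (trans
          (cong₂ _++_ (sym tyA) (cong₂ _++_ (trans (types-zip ys _ (length≡ fa)) (sym (types-zip ys′ _ (length≡ fa′))))
                                            (sym tyB)))
          (sym (types-++³ Δa′ (argCtx ys′) Δb′)))
        r₂ = expand-then-contract Γ₁ (Δa ++ K ++ Δb) Δa′ x′ S Δb′ Γ₂ w d₁′
               (≤-trans (≤-reflexive (trans (contractions-castCtx premise≡ d₁) eq₁)) le) S≡cod ys′ fa′ blocks-types
        term≡ = expanded-twins-term≡ Γ₁ Δa S Δb Δa′ x′ Δb′ Γ₂ x t ys ys′ (⊢-distinct d) (⊢-scoped d) tyA tyB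
                  (FreshArgs-⊆ (∈-++⁺ʳ (vars (Γ₁ ++ Dx ++ Γ₂)) ∘ ∈-++⁺ˡ) fa)
                  (FreshArgs-⊆ (∈-++⁺ˡ ∘ subst (_ ∈_) (cong vars premise≡)) fa′)

      expand-then-contract : ∀ {n t C} Γ₁ Ξ Δa′ x′ S Δb′ Γ₂ → contraction ≡ true →
        (d : Γ₁ ++ Ξ ++ (Δa′ ++ (x′ , S) ∷ Δb′) ++ Γ₂ ⊢ t ∶ C) → contractions d ≤ n → S ≡ cod f →
        ∀ ys′ → FreshArgs ys′ (allVars d) → types Ξ ≡ types (Δa′ ++ argCtx ys′ ++ Δb′) →
        Σ[ d′ ∈ Γ₁ ++ Ξ ++ Γ₂ ⊢ bindT (expansion x′ ys′) t [ map var (vars Ξ) / vars (Δa′ ++ argCtx ys′ ++ Δb′) ] ∶ C ]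
          contractions d′ ≡ suc (contractions d)
      expand-then-contract Γ₁ Ξ Δa′ x′ S Δb′ Γ₂ w d le S≡cod ys′ fa tyΞ =
        contract {Γ₁ = Γ₁} {Ξ} {Δa′ ++ argCtx ys′ ++ Δb′} {Γ₂} w tyΞ (castCtx expanded≡ (proj₁ r)) ,
        cong suc (trans (contractions-castCtx expanded≡ (proj₁ r)) (proj₂ r))
        where
        L′ = Γ₁ ++ Ξ ++ Δa′
        shape : Γ₁ ++ Ξ ++ (Δa′ ++ (x′ , S) ∷ Δb′) ++ Γ₂ ≡ L′ ++ (x′ , S) ∷ Δb′ ++ Γ₂
        shape = solve 6 (λ g k a xx b e → g ⊕ (k ⊕ ((a ⊕ (xx ⊕ b)) ⊕ e)) ⊜ (g ⊕ (k ⊕ a)) ⊕ (xx ⊕ (b ⊕ e))) refl Γ₁ Ξ Δa′ ((x′ , S) ∷ []) Δb′ Γ₂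
        apart = Distinct-at L′ (Δb′ ++ Γ₂) (subst Distinct shape (⊢-distinct d))
        at : AtSort x′ (cod f) (Γ₁ ++ Ξ ++ (Δa′ ++ (x′ , S) ∷ Δb′) ++ Γ₂)
        at x′,A∈ = trans (Distinct⇒sort-unique (⊢-distinct d) x′,A∈ (subst (_ ∈_) (sym shape) (∈-++⁺ʳ L′ (here refl)))) S≡cod
        r = expand d le x′ ys′ fa at
        expanded≡ : expandCtx x′ ys′ (Γ₁ ++ Ξ ++ (Δa′ ++ (x′ , S) ∷ Δb′) ++ Γ₂) ≡ Γ₁ ++ Ξ ++ (Δa′ ++ argCtx ys′ ++ Δb′) ++ Γ₂
        expanded≡ = trans (cong (expandCtx x′ ys′) shape) (trans (expandCtx-at x′ ys′ L′ S (Δb′ ++ Γ₂) (proj₁ apart) (proj₂ apart))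
          (solve 6 (λ g k a xx b e → (g ⊕ (k ⊕ a)) ⊕ (xx ⊕ (b ⊕ e)) ⊜ g ⊕ (k ⊕ ((a ⊕ (xx ⊕ b)) ⊕ e))) refl Γ₁ Ξ Δa′ (argCtx ys′) Δb′ Γ₂))

  -- Cut

  ⊢-singleton : ∀ {Γ t B} → Γ ⊢ t ∶ B ∷ [] → Σ[ a ∈ ATerm ] t ≡ a ∷ []
  ⊢-singleton {t = t} d with t | ⊢-length d
  ... | a ∷ [] | _ = a , refl

  cut-variable : ∀ y A Δa x Δb {t C} → Δa ++ (x , A) ∷ Δb ⊢ t ∶ C → y ∉ vars (Δa ++ (x , A) ∷ Δb) →
    Δa ++ (y , A) ∷ Δb ⊢ bindT (x ∷ [] ↦ var y ∷ []) t ∶ C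
  cut-variable y A Δa x Δb {t} dt y∉ = castTerm term≡ (castCtx ctx≡ (rename ρ ρ-injective dt))
    where
    x≢y : x ≢ y
    x≢y refl = y∉ (∈vars-++⁺ʳ Δa _ (here refl))
    ρ = transpose (x ∷ []) (y ∷ [])
    ρ-injective = transpose-injective (Unique-∷ (λ ()) []) (Unique-∷ (λ ()) []) λ { (here refl , here refl) → x≢y refl }
    apart = Distinct-at Δa Δb (⊢-distinct dt)
    ρ-fix : ∀ {v} → v ≢ x → v ∈ vars (Δa ++ (x , A) ∷ Δb) → ρ v ≡ v
    ρ-fix v≢x v∈ = transpose-fix (x ∷ []) (y ∷ []) (λ { (here refl) → v≢x refl }) (λ { (here refl) → y∉ v∈ })
    ctx≡ : renameCtx ρ (Δa ++ (x , A) ∷ Δb) ≡ Δa ++ (y , A) ∷ Δb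
    ctx≡ = trans (renameCtx-++ ρ Δa _) (cong₂ _++_
      (renameCtx-id-on ρ Δa (λ v∈ → ρ-fix (λ { refl → proj₁ apart v∈ }) (∈vars-++⁺ˡ Δa _ v∈)))
      (cong₂ _∷_ (cong (_, A) (transpose-head {x} {y} [] []))
        (renameCtx-id-on ρ Δb (λ v∈ → ρ-fix (λ { refl → proj₂ apart v∈ }) (∈vars-++⁺ʳ Δa _ (there v∈))))))
    term≡ : bindT (var ∘ ρ) t ≡ bindT (x ∷ [] ↦ var y ∷ []) t
    term≡ = bindT-cong-on t (⊢-scoped dt) pointwise
      where
      pointwise : ∀ {v} → v ∈ vars (Δa ++ (x , A) ∷ Δb) → var (ρ v) ≡ (x ∷ [] ↦ var y ∷ []) v
      pointwise {v} v∈ with v ≟ x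
      ... | yes refl = refl
      ... | no _ with v ≟ y
      ...   | yes refl = ⊥-elim (y∉ v∈)
      ...   | no _     = refl

  Singletons : List Term → Set
  Singletons = All (λ s → Σ[ a ∈ ATerm ] s ≡ a ∷ [])

  args-singletons : ∀ {Γs ss Bs} → Args false Γs ss Bs → Singletons ss
  args-singletons []         = []
  args-singletons (d ∷ args) = ⊢-singleton d ∷ args-singletons args

  length-concat-singletons : ∀ {ss} → Singletons ss → length (concat ss) ≡ length ss
  length-concat-singletons []                 = refl
  length-concat-singletons ((a , refl) ∷ sss) = cong suc (length-concat-singletons sss)

  map-∷[]-concat-singletons : ∀ {ss} → Singletons ss → map (_∷ []) (concat ss) ≡ ss
  map-∷[]-concat-singletons []                 = refl
  map-∷[]-concat-singletons ((a , refl) ∷ sss) = cong ((a ∷ []) ∷_) (map-∷[]-concat-singletons sss)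

  appVars-args : ∀ g ys ss → Unique ys → length ys ≡ length ss → Singletons ss →
    bindA (ys ↦ concat ss) (Expansion.appVars g ys) ≡ app g ss
  appVars-args g ys ss u len sss = trans (Expansion.bindA-appVars g _ ys) (cong (app g) (begin
    map (λ y → (ys ↦ concat ss) y ∷ []) ys    ≡⟨ map-∘ ys ⟩
    map (_∷ []) (map (ys ↦ concat ss) ys)     ≡⟨ cong (map (_∷ [])) ys↦css ⟩
    map (_∷ []) (concat ss)                   ≡⟨ map-∷[]-concat-singletons sss ⟩
    ss                                        ∎))
    where
    open ≡-Reasoning
    ys↦css : map (ys ↦ concat ss) ys ≡ concat ss
    ys↦css = subst₂ (λ xs s → map (xs ↦ s) ys ≡ concat ss) (++-identityʳ ys) (++-identityʳ (concat ss))
               (↦-head-block ys (concat ss) u (trans len (sym (length-concat-singletons sss))))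

  rename-cut-contracted : ∀ (ρ : Var → Var) → Injective _≡_ _≡_ ρ → (∀ v → ρ (ρ v) ≡ v) →
    ∀ Γ₁ D D′ Γ₂ Δx s′ t {V} → types D ≡ types D′ → ScopedT V t → ScopedT (vars (Γ₁ ++ D ++ D′ ++ Γ₂)) s′ →
    length (vars Δx) ≡ length s′ → (∀ {v} → v ∈ vars (Γ₁ ++ D ++ Γ₂) → ρ v ≡ v) → (∀ {v} → v ∈ V → ρ v ∉ vars D′) →
    bindT (var ∘ ρ) (bindT (vars (renameCtx ρ Δx) ↦ s′) (bindT (var ∘ ρ) t) [ map var (vars D) / vars D′ ])
      ≡ bindT (vars Δx ↦ s′ [ map var (vars D) / vars D′ ]) t
  rename-cut-contracted ρ ρ-injective ρ-involutive Γ₁ D D′ Γ₂ Δx s′ t tyD sc-t sc-s′ len ρ-fix ρ-moves = begin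
    bindT (var ∘ ρ) (bindT (vars (renameCtx ρ Δx) ↦ s′) (bindT (var ∘ ρ) t) [ map var (vars D) / vars D′ ])
      ≡⟨ cong (bindT (var ∘ ρ)) ([/]≡bindT _ _ (vars D′)) ⟩
    bindT (var ∘ ρ) (bindT zD (bindT (vars (renameCtx ρ Δx) ↦ s′) (bindT (var ∘ ρ) t)))
      ≡⟨ cong (λ xs → bindT (var ∘ ρ) (bindT zD (bindT (xs ↦ s′) (bindT (var ∘ ρ) t)))) (vars-renameCtx ρ Δx) ⟩
    bindT (var ∘ ρ) (bindT zD (bindT (map ρ (vars Δx) ↦ s′) (bindT (var ∘ ρ) t)))
      ≡⟨ cong (bindT (var ∘ ρ)) (trans (cong (bindT zD) (bindT-∘ _ _ t)) (bindT-∘ _ _ t)) ⟩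
    bindT (var ∘ ρ) (bindT (λ v → bindA zD ((map ρ (vars Δx) ↦ s′) (ρ v))) t)
      ≡⟨ bindT-∘ _ _ t ⟩
    bindT (λ v → bindA (var ∘ ρ) (bindA zD ((map ρ (vars Δx) ↦ s′) (ρ v)))) t
      ≡⟨ bindT-cong-on t sc-t pointwise ⟩
    bindT (vars Δx ↦ map (bindA zD) s′) t
      ≡⟨ cong (λ s → bindT (vars Δx ↦ s) t) (trans (sym (bindT≡map zD s′)) (sym ([/]≡bindT s′ _ (vars D′)))) ⟩
    bindT (vars Δx ↦ s′ [ map var (vars D) / vars D′ ]) t ∎
    where
    open ≡-Reasoning
    zD = vars D′ ↦ map var (vars D)
    pointwise : ∀ {v} → v ∈ _ → bindA (var ∘ ρ) (bindA zD ((map ρ (vars Δx) ↦ s′) (ρ v))) ≡ (vars Δx ↦ map (bindA zD) s′) v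
    pointwise {v} v∈V with v ∈? vars Δx
    ... | yes v∈Δx = begin
      bindA (var ∘ ρ) (bindA zD ((map ρ (vars Δx) ↦ s′) (ρ v)))
        ≡⟨ cong (bindA (var ∘ ρ) ∘ bindA zD) (↦-rename-domain ρ ρ-injective (vars Δx) s′ v∈Δx len) ⟩
      bindA (var ∘ ρ) (bindA zD ((vars Δx ↦ s′) v))
        ≡⟨ bindA-id-on (bindA zD ((vars Δx ↦ s′) v))
             (ScopedA-bind ((vars Δx ↦ s′) v) (↦-scoped (vars Δx) s′ sc-s′ len v∈Δx) (contraction-scoped Γ₁ D D′ Γ₂ tyD))
             (λ w∈ → cong var (ρ-fix w∈)) ⟩
      bindA zD ((vars Δx ↦ s′) v)
        ≡⟨ ↦-bind zD (vars Δx) s′ v len (λ v∉Δx → ⊥-elim (v∉Δx v∈Δx)) ⟨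
      (vars Δx ↦ map (bindA zD) s′) v ∎
    ... | no v∉Δx = begin
      bindA (var ∘ ρ) (bindA zD ((map ρ (vars Δx) ↦ s′) (ρ v)))
        ≡⟨ cong (bindA (var ∘ ρ) ∘ bindA zD) (↦-∉ (map ρ (vars Δx)) s′ ρv∉) ⟩
      bindA (var ∘ ρ) (zD (ρ v))   ≡⟨ cong (bindA (var ∘ ρ)) (↦-∉ (vars D′) _ (ρ-moves v∈V)) ⟩
      var (ρ (ρ v))                ≡⟨ cong var (ρ-involutive v) ⟩
      var v                        ≡⟨ ↦-∉ (vars Δx) _ v∉Δx ⟨
      (vars Δx ↦ map (bindA zD) s′) v ∎
      where
      ρv∉ : ρ v ∉ map ρ (vars Δx)
      ρv∉ ρv∈ with ∈-map⁻ ρ ρv∈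
      ... | w , w∈Δx , ρv≡ρw = v∉Δx (subst (_∈ vars Δx) (sym (ρ-injective ρv≡ρw)) w∈Δx)

  mutual
    cut : ∀ {Γ s B} → Γ ⊢ s ∶ B → ∀ Δa Δx Δb {t C} → Δa ++ Δx ++ Δb ⊢ t ∶ C → types Δx ≡ B →
      Disjoint (vars Γ) (vars (Δa ++ Δx ++ Δb)) → Δa ++ Γ ++ Δb ⊢ bindT (vars Δx ↦ s) t ∶ C
    cut (variable′ y A) Δa Δx Δb dt ty dj with types-singleton Δx ty
    ... | x , refl = cut-variable y A Δa x Δb dt (λ y∈ → dj (here refl , y∈))
    cut (function g {Γs} {ss} args u) Δa Δx Δb {t} dt ty dj with types-singleton Δx ty
    ... | x , refl =
      castTerm term≡ (cutArgs args u Δa Δb ys (length≡ fa) (castCtx ctx≡ (proj₁ (expand dt ≤-refl x ys fa at))) dj′)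
      where
      open Expansion g
      open FreshArgs
      ys = freshVars (allVars dt ++ vars (concat Γs)) (length (dom g))
      ys-fresh : Disjoint ys (allVars dt ++ vars (concat Γs))
      ys-fresh = fresh (freshArgs (allVars dt ++ vars (concat Γs)))
      fa : FreshArgs ys (allVars dt)
      fa = FreshArgs-⊆ ∈-++⁺ˡ (freshArgs (allVars dt ++ vars (concat Γs)))
      apart = Distinct-at Δa Δb (⊢-distinct dt)
      at : AtSort x (cod g) (Δa ++ (x , cod g) ∷ Δb)
      at x,A∈ = Distinct⇒sort-unique (⊢-distinct dt) x,A∈ (∈-++⁺ʳ Δa (here refl))
      ctx≡ : expandCtx x ys (Δa ++ (x , cod g) ∷ Δb) ≡ Δa ++ argCtx ys ++ Δb
      ctx≡ = expandCtx-at x ys Δa (cod g) Δb (proj₁ apart) (proj₂ apart)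
      dj′ : Disjoint (vars (concat Γs)) (vars (Δa ++ argCtx ys ++ Δb))
      dj′ (v∈Γs , v∈) with ∈vars-++⁻ Δa _ v∈
      ... | inj₁ v∈Δa = dj (v∈Γs , ∈vars-++⁺ˡ Δa _ v∈Δa)
      ... | inj₂ v∈′ with ∈vars-++⁻ (argCtx ys) Δb v∈′
      ...   | inj₁ v∈ys = ys-fresh (subst (_ ∈_) (vars-argCtx ys (length≡ fa)) v∈ys , ∈-++⁺ʳ (allVars dt) v∈Γs)
      ...   | inj₂ v∈Δb = dj (v∈Γs , ∈vars-++⁺ʳ Δa _ (there v∈Δb))
      pointwise : ∀ {v} → v ∈ vars (Δa ++ (x , cod g) ∷ Δb) → bindA (ys ↦ concat ss) (expansion x ys v) ≡ (x ∷ [] ↦ app g ss ∷ []) v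
      pointwise {v} v∈ with v ≟ x
      ... | yes refl = appVars-args g ys ss (unique fa) (trans (length≡ fa) (sym (args-length args))) (args-singletons args)
      ... | no _     = ↦-∉ ys _ (λ v∈ys → fresh fa (v∈ys , ∈-++⁺ˡ v∈))
      term≡ : bindT (ys ↦ concat ss) (bindT (expansion x ys) t) ≡ bindT (x ∷ [] ↦ app g ss ∷ []) t
      term≡ = trans (bindT-∘ _ _ t) (bindT-cong-on t (⊢-scoped dt) pointwise)
    cut (substitution () _ _ _) _ _ _ _ _ _
    cut unit Δa Δx Δb {t} dt ty dj with types-empty Δx ty
    ... | refl = castTerm (sym (bindT-var t)) dt
    cut (tensor {Γ = Γ₁} {Γ₂} {s₁} {s₂} {B₁} {B₂} d e u) Δa Δx Δb {t} dt ty dj with types-split Δx B₁ B₂ ty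
    ... | Δ₁ , Δ₂ , refl , ty₁ , ty₂ = castTerm term≡ (castCtx ctx≡ second)
      where
      reassoc : Δa ++ (Δ₁ ++ Δ₂) ++ Δb ≡ Δa ++ Δ₁ ++ Δ₂ ++ Δb
      reassoc = cong (Δa ++_) (++-assoc Δ₁ Δ₂ Δb)
      first = cut d Δa Δ₁ (Δ₂ ++ Δb) (castCtx reassoc dt) ty₁
                (λ (v∈Γ₁ , v∈) → dj (∈vars-++⁺ˡ Γ₁ Γ₂ v∈Γ₁ , subst (λ Θ → _ ∈ vars Θ) (sym reassoc) v∈))
      dj₂ : Disjoint (vars Γ₂) (vars ((Δa ++ Γ₁) ++ Δ₂ ++ Δb))
      dj₂ (v∈Γ₂ , v∈) with ∈vars-++⁻ (Δa ++ Γ₁) _ v∈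
      ... | inj₂ v∈Δ₂Δb = dj (∈vars-++⁺ʳ Γ₁ Γ₂ v∈Γ₂ , subst (λ Θ → _ ∈ vars Θ) (sym reassoc) (∈vars-++⁺ʳ Δa _ (∈vars-++⁺ʳ Δ₁ _ v∈Δ₂Δb)))
      ... | inj₁ v∈′ with ∈vars-++⁻ Δa Γ₁ v∈′
      ...   | inj₁ v∈Δa = dj (∈vars-++⁺ʳ Γ₁ Γ₂ v∈Γ₂ , ∈vars-++⁺ˡ Δa _ v∈Δa)
      ...   | inj₂ v∈Γ₁ = Distinct-++⇒Disjoint Γ₁ u (v∈Γ₁ , v∈Γ₂)
      second = cut e (Δa ++ Γ₁) Δ₂ Δb (castCtx (sym (++-assoc Δa Γ₁ _)) first) ty₂ dj₂
      ctx≡ : (Δa ++ Γ₁) ++ Γ₂ ++ Δb ≡ Δa ++ (Γ₁ ++ Γ₂) ++ Δb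
      ctx≡ = solve 4 (λ a g c b → (a ⊕ g) ⊕ (c ⊕ b) ⊜ a ⊕ ((g ⊕ c) ⊕ b)) refl Δa Γ₁ Γ₂ Δb
      len₁ : length (vars Δ₁) ≡ length s₁
      len₁ = trans (length-vars Δ₁) (trans (cong length ty₁) (sym (⊢-length d)))
      Γ₁#Δ₂ : Disjoint (vars Γ₁) (vars Δ₂)
      Γ₁#Δ₂ (v∈Γ₁ , v∈Δ₂) = dj (∈vars-++⁺ˡ Γ₁ Γ₂ v∈Γ₁ , ∈vars-++⁺ʳ Δa _ (∈vars-++⁺ˡ (Δ₁ ++ Δ₂) Δb (∈vars-++⁺ʳ Δ₁ Δ₂ v∈Δ₂)))
      term≡ : bindT (vars Δ₂ ↦ s₂) (bindT (vars Δ₁ ↦ s₁) t) ≡ bindT (vars (Δ₁ ++ Δ₂) ↦ s₁ ++ s₂) t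
      term≡ = trans (bindT-∘ _ _ t) (trans (bindT-cong t (↦-++-sequential (vars Δ₁) (vars Δ₂) s₁ s₂ len₁ (⊢-scoped d) Γ₁#Δ₂))
                (cong (λ xs → bindT (xs ↦ s₁ ++ s₂) t) (sym (vars-++ Δ₁ Δ₂))))
    cut (weaken {Γ₁ = Γ₁} {Γ₂} {Γ₃} w d u) Δa Δx Δb dt ty dj =
      castCtx ctx≡ (weaken {Γ₁ = Δa ++ Γ₁} {Γ₂} {Γ₃ ++ Δb} w (castCtx reassoc (cut d Δa Δx Δb dt ty dj′)) distinct)
      where
      dj′ : Disjoint (vars (Γ₁ ++ Γ₃)) (vars (Δa ++ Δx ++ Δb))
      dj′ (v∈ , v∈Δ) = dj (∈vars-middle Γ₁ Γ₂ Γ₃ v∈ , v∈Δ)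
      reassoc : Δa ++ (Γ₁ ++ Γ₃) ++ Δb ≡ (Δa ++ Γ₁) ++ Γ₃ ++ Δb
      reassoc = solve 4 (λ a g c b → a ⊕ ((g ⊕ c) ⊕ b) ⊜ (a ⊕ g) ⊕ (c ⊕ b)) refl Δa Γ₁ Γ₃ Δb
      ctx≡ : (Δa ++ Γ₁) ++ Γ₂ ++ Γ₃ ++ Δb ≡ Δa ++ (Γ₁ ++ Γ₂ ++ Γ₃) ++ Δb
      ctx≡ = solve 5 (λ a g₁ g₂ g₃ b → (a ⊕ g₁) ⊕ (g₂ ⊕ (g₃ ⊕ b)) ⊜ a ⊕ ((g₁ ⊕ (g₂ ⊕ g₃)) ⊕ b)) refl Δa Γ₁ Γ₂ Γ₃ Δb
      outer-apart : Disjoint (vars (Γ₁ ++ Γ₂ ++ Γ₃)) (vars (Δa ++ Δb))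
      outer-apart (v∈ , v∈ΔaΔb) = dj (v∈ , ∈vars-middle Δa Δx Δb v∈ΔaΔb)
      distinct : Distinct ((Δa ++ Γ₁) ++ Γ₂ ++ Γ₃ ++ Δb)
      distinct = subst Distinct (sym ctx≡) (Distinct-↭ (↭.shifts (Γ₁ ++ Γ₂ ++ Γ₃) Δa)
        (Distinct-++⁺ u (Distinct-drop-middle Δa Δx Δb (⊢-distinct dt)) outer-apart))
    cut (exch w d Γ↭Γ′) Δa Δx Δb dt ty dj =
      exch w (cut d Δa Δx Δb dt ty (λ (v∈ , v∈Δ) → dj (∈vars-↭ Γ↭Γ′ v∈ , v∈Δ))) (↭.++⁺ˡ Δa (↭.++⁺ʳ Δb Γ↭Γ′))
    cut (contract {Γ₁ = Γ₁} {D} {D′} {Γ₂} {s′} w tyD d) Δa Δx Δb {t} dt ty dj =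
      castTerm term≡ (castCtx ctx≡ (rename ρ ρ-injective (castCtx reassoc contracted)))
      where
      open RenameApart (vars (Δa ++ Δx ++ Δb)) (allVars d) (⊢-distinct dt)
        renaming (apart to ρ; apart-injective to ρ-injective; apart-involutive to ρ-involutive)
      ρΔ≡ = renameCtx-++³ ρ Δa Δx Δb
      dj′ : Disjoint (vars (Γ₁ ++ D ++ D′ ++ Γ₂)) (vars (renameCtx ρ Δa ++ renameCtx ρ Δx ++ renameCtx ρ Δb))
      dj′ (v∈ , v∈ρΔ) with ∈-map⁻ ρ (subst (_ ∈_) (vars-renameCtx ρ (Δa ++ Δx ++ Δb)) (subst (λ Θ → _ ∈ vars Θ) (sym ρΔ≡) v∈ρΔ))
      ... | w , w∈Δ , refl = apart-∉ w∈Δ (∈-++⁺ˡ v∈)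
      inner = cut d (renameCtx ρ Δa) (renameCtx ρ Δx) (renameCtx ρ Δb) (castCtx ρΔ≡ (rename ρ ρ-injective dt))
                (trans (types-renameCtx ρ Δx) ty) dj′
      contracted = contract {Γ₁ = renameCtx ρ Δa ++ Γ₁} {D} {D′} {Γ₂ ++ renameCtx ρ Δb} w tyD
        (castCtx (solve 6 (λ a g x y h b → a ⊕ ((g ⊕ (x ⊕ (y ⊕ h))) ⊕ b) ⊜ (a ⊕ g) ⊕ (x ⊕ (y ⊕ (h ⊕ b))))
                   refl (renameCtx ρ Δa) Γ₁ D D′ Γ₂ (renameCtx ρ Δb)) inner)
      reassoc : (renameCtx ρ Δa ++ Γ₁) ++ D ++ Γ₂ ++ renameCtx ρ Δb ≡ renameCtx ρ Δa ++ (Γ₁ ++ D ++ Γ₂) ++ renameCtx ρ Δb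
      reassoc = solve 5 (λ a g x h b → (a ⊕ g) ⊕ (x ⊕ (h ⊕ b)) ⊜ a ⊕ ((g ⊕ (x ⊕ h)) ⊕ b)) refl (renameCtx ρ Δa) Γ₁ D Γ₂ (renameCtx ρ Δb)
      ρ-fixes : ∀ {v} → v ∈ vars (Γ₁ ++ D ++ Γ₂) → ρ v ≡ v
      ρ-fixes v∈ = apart-fix (λ v∈Δ → dj (v∈ , v∈Δ))
        (∈-++⁺ˡ ([ ∈vars-++⁺ˡ Γ₁ (D ++ D′ ++ Γ₂) , ∈vars-++⁺ʳ Γ₁ (D ++ D′ ++ Γ₂) ∘ ∈vars-middle D D′ Γ₂ ]′ (∈vars-++⁻ Γ₁ (D ++ Γ₂) v∈)))
      ctx≡ : renameCtx ρ (renameCtx ρ Δa ++ (Γ₁ ++ D ++ Γ₂) ++ renameCtx ρ Δb) ≡ Δa ++ (Γ₁ ++ D ++ Γ₂) ++ Δb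
      ctx≡ = trans (renameCtx-++³ ρ (renameCtx ρ Δa) (Γ₁ ++ D ++ Γ₂) (renameCtx ρ Δb)) (cong₂ _++_ (renameCtx-involutive ρ ρ-involutive Δa)
               (cong₂ _++_ (renameCtx-id-on ρ (Γ₁ ++ D ++ Γ₂) ρ-fixes) (renameCtx-involutive ρ ρ-involutive Δb)))
      term≡ = rename-cut-contracted ρ ρ-injective ρ-involutive Γ₁ D D′ Γ₂ Δx s′ t tyD (⊢-scoped dt) (⊢-scoped d)
                (trans (length-vars Δx) (trans (cong length ty) (sym (⊢-length d)))) ρ-fixes
                (λ v∈Δ ρv∈D′ → apart-∉ v∈Δ (∈-++⁺ˡ (∈vars-++⁺ʳ Γ₁ _ (∈vars-++⁺ʳ D _ (∈vars-++⁺ˡ D′ Γ₂ ρv∈D′)))))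

    cutArgs : ∀ {Γs ss Bs} → Args false Γs ss Bs → Distinct (concat Γs) → ∀ Δa Δb ys {u C} → length ys ≡ length Bs →
      Δa ++ zip ys Bs ++ Δb ⊢ u ∶ C → Disjoint (vars (concat Γs)) (vars (Δa ++ zip ys Bs ++ Δb)) →
      Δa ++ concat Γs ++ Δb ⊢ bindT (ys ↦ concat ss) u ∶ C
    cutArgs [] _ Δa Δb [] {u} _ du _ = castTerm (sym (bindT-var u)) du
    cutArgs (_∷_ {Γ} {s} {B} {Γs} {ss} {Bs} d args) U Δa Δb (y ∷ ys) {u} {C} len du dj with ⊢-singleton d
    ... | a , refl = castTerm term≡ (castCtx ctx≡ rest)
      where
      first : Δa ++ Γ ++ zip ys Bs ++ Δb ⊢ bindT (y ∷ [] ↦ a ∷ []) u ∶ C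
      first = cut d Δa ((y , B) ∷ []) (zip ys Bs ++ Δb) du refl (λ (v∈Γ , v∈) → dj (∈vars-++⁺ˡ Γ _ v∈Γ , v∈))
      dj₂ : Disjoint (vars (concat Γs)) (vars ((Δa ++ Γ) ++ zip ys Bs ++ Δb))
      dj₂ (v∈Γs , v∈) with ∈vars-++⁻ (Δa ++ Γ) _ v∈
      ... | inj₂ v∈′ = dj (∈vars-++⁺ʳ Γ _ v∈Γs , ∈vars-++⁺ʳ Δa _ (there v∈′))
      ... | inj₁ v∈′ with ∈vars-++⁻ Δa Γ v∈′
      ...   | inj₁ v∈Δa = dj (∈vars-++⁺ʳ Γ _ v∈Γs , ∈vars-++⁺ˡ Δa _ v∈Δa)
      ...   | inj₂ v∈Γ  = Distinct-++⇒Disjoint Γ U (v∈Γ , v∈Γs)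
      rest = cutArgs args (Distinct-++⁻ʳ Γ U) (Δa ++ Γ) Δb ys (suc-injective len) (castCtx (sym (++-assoc Δa Γ _)) first) dj₂
      ctx≡ : (Δa ++ Γ) ++ concat Γs ++ Δb ≡ Δa ++ (Γ ++ concat Γs) ++ Δb
      ctx≡ = solve 4 (λ a g c b → (a ⊕ g) ⊕ (c ⊕ b) ⊜ a ⊕ ((g ⊕ c) ⊕ b)) refl Δa Γ (concat Γs) Δb
      Γ#ys : Disjoint (vars Γ) ys
      Γ#ys (v∈Γ , v∈ys) = dj (∈vars-++⁺ˡ Γ _ v∈Γ , ∈vars-++⁺ʳ Δa _ (there (∈vars-++⁺ˡ (zip ys Bs) Δb
                            (subst (_ ∈_) (sym (vars-zip ys Bs (suc-injective len))) v∈ys))))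
      term≡ : bindT (ys ↦ concat ss) (bindT (y ∷ [] ↦ a ∷ []) u) ≡ bindT (y ∷ ys ↦ a ∷ concat ss) u
      term≡ = trans (bindT-∘ _ _ u) (bindT-cong u (↦-++-sequential (y ∷ []) ys (a ∷ []) (concat ss) refl (⊢-scoped d) Γ#ys))

  substitution-admissible : ∀ {Γ s B Δ t C} → Γ ⊢ s ∶ B → Δ ⊢ t ∶ C → types Δ ≡ B → Γ ⊢ t [ s / vars Δ ] ∶ C
  substitution-admissible {Γ} {s} {B} {Δ} {t} ds dt ty =
    castTerm term≡ (castCtx (++-identityʳ Γ) (cut ds [] (renameCtx ρ Δ) [] (castCtx (sym (++-identityʳ _)) (rename ρ ρ-injective dt))
      (trans (types-renameCtx ρ Δ) ty) apart))
    where
    open RenameApart (vars Δ) (vars Γ) (⊢-distinct dt) renaming (apart to ρ; apart-injective to ρ-injective)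
    apart : Disjoint (vars Γ) (vars ([] ++ renameCtx ρ Δ ++ []))
    apart (v∈Γ , v∈) with ∈-map⁻ ρ (subst (_ ∈_) (vars-renameCtx ρ Δ) (subst (λ Θ → _ ∈ vars Θ) (++-identityʳ _) v∈))
    ... | w , w∈Δ , refl = apart-∉ w∈Δ v∈Γ
    len : length (vars Δ) ≡ length s
    len = trans (length-vars Δ) (trans (cong length ty) (sym (⊢-length ds)))
    term≡ : bindT (vars (renameCtx ρ Δ) ↦ s) (bindT (var ∘ ρ) t) ≡ t [ s / vars Δ ]
    term≡ = begin
      bindT (vars (renameCtx ρ Δ) ↦ s) (bindT (var ∘ ρ) t)  ≡⟨ cong (λ xs → bindT (xs ↦ s) (bindT (var ∘ ρ) t)) (vars-renameCtx ρ Δ) ⟩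
      bindT (map ρ (vars Δ) ↦ s) (bindT (var ∘ ρ) t)        ≡⟨ bindT-∘ _ _ t ⟩
      bindT (λ v → (map ρ (vars Δ) ↦ s) (ρ v)) t
        ≡⟨ bindT-cong-on t (⊢-scoped dt) (λ v∈ → ↦-rename-domain ρ ρ-injective (vars Δ) s v∈ len) ⟩
      bindT (vars Δ ↦ s) t                                  ≡⟨ [/]≡bindT t s (vars Δ) ⟨
      t [ s / vars Δ ]                                      ∎
      where open ≡-Reasoning

  mutual
    eliminate-substitution : ∀ {Γ t B} → Γ ⊢[ true ] t ∶ B → Γ ⊢ t ∶ B
    eliminate-substitution (variable′ x A)          = variable′ x A
    eliminate-substitution (function f args u)      = function f (eliminate-substitutionArgs args) u
    eliminate-substitution (substitution _ ds dt ty) =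
      substitution-admissible (eliminate-substitution ds) (eliminate-substitution dt) ty
    eliminate-substitution unit                     = unit
    eliminate-substitution (tensor d e u)           = tensor (eliminate-substitution d) (eliminate-substitution e) u
    eliminate-substitution (weaken {Γ₁ = Γ₁} {Γ₂} {Γ₃} w d u) =
      weaken {Γ₁ = Γ₁} {Γ₂} {Γ₃} w (eliminate-substitution d) u
    eliminate-substitution (exch w d Γ↭Γ′)          = exch w (eliminate-substitution d) Γ↭Γ′
    eliminate-substitution (contract {Γ₁ = Γ₁} {Δ} {Δ′} {Γ₂} w ty d) =
      contract {Γ₁ = Γ₁} {Δ} {Δ′} {Γ₂} w ty (eliminate-substitution d)

    eliminate-substitutionArgs : ∀ {Γs ts Bs} → Args true Γs ts Bs → Args false Γs ts Bs
    eliminate-substitutionArgs []         = []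
    eliminate-substitutionArgs (d ∷ args) = eliminate-substitution d ∷ eliminate-substitutionArgs args

corollary5p2 : (L : Language) → let open Calculus L in
    ∀ {Γ t B} → Γ ⊢[ true ] t ∶ B → Γ ⊢[ false ] t ∶ B
corollary5p2 L = eliminate-substitution L
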